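{- For $k\ge 0$, let $B_k(x)$ be the ordinary generating function, with respect to length, of the paths in $\mathcal{H}$ whose maximal height is at most $k$. Then for every $k\ge 1$, $$B_{k-1}(x)=\frac{(1-x^3+x)B_k(x)-1}{x^2B_k(x)+x}.$$
   Context: A Dyck path with air pockets (DAP) is a nonempty lattice path starting at $(0,0)$, ending on the $x$-axis, never going below the $x$-axis, consisting of up-steps $U=(1,1)$ and down-steps $D_k=(1,-k)$ with $k\ge 1$, such that no two down-steps are consecutive; $D$ denotes $D_1$. A DAP is prime if it ends with a step $D_k$ with $k\ge 2$ and touches the $x$-axis only at its endpoints; let $\mathcal{P}$ be the set of prime DAP. Any prime DAP can be written uniquely as $\alpha=\beta\,U D_k$ with $k\ge 2$ (where $\beta$ starts with $U$); its lowering is the DAP $\alpha^\flat$ obtained by deleting the first step of $\alpha$ and replacing the final step $D_k$ by $D_{k-1}$ (i.e. if $\alpha=U\beta' UD_k$ then $\alpha^\flat=\beta' UD_{k-1}$). For a path $\gamma$, $h(\gamma)$ denotes the maximal ordinate reached by $\gamma$ ($h(\varepsilon)=0$). The set $\mathcal{H}$ is defined recursively as the union of the empty path and all DAP $\gamma$ whose first return decomposition $\gamma=\alpha\beta$ (where $\alpha$ is the prefix of $\gamma$ up to its first return to the $x$-axis, so $\alpha\in\mathcal{P}\cup\{UD\}$) satisfies: $\alpha^\flat\in\mathcal{H}$ whenever $\alpha\neq UD$, $\beta\in\mathcal{H}$, and $h(\alpha)\ge h(\beta)$. The length of a path is its number of steps. -}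

module Defs where

open import Data.Bool using (Bool; true; false; _∧_; _∨_; if_then_else_)
open import Data.Nat using (ℕ; zero; suc; _∸_; _⊔_; _≡ᵇ_; _≤ᵇ_)
open import Data.List using (List; []; _∷_; map; concatMap; upTo; length; filterᵇ)
open import Data.Product using (_×_; _,_; map₁)
open import Data.Integer as ℤ using (ℤ; +_)

-- Steps and paths.  U = (1,1);  D m encodes the down-step D_{m+1} = (1,-(m+1)),
-- so every down-step has k ≥ 1 by construction.  D 0 is D = D_1.

data Step : Set where
  U : Step
  D : ℕ → Step

Path : Set
Path = List Step

stepH : ℕ → Step → ℕ
stepH h U     = suc h
stepH h (D m) = h ∸ suc m

validFrom : ℕ → Path → Bool
validFrom h []          = h ≡ᵇ 0
validFrom h (U ∷ s)     = validFrom (suc h) s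
validFrom h (D m ∷ s)   = (suc m ≤ᵇ h) ∧ validFrom (h ∸ suc m) s

noDD : Path → Bool
noDD []                = true
noDD (U ∷ s)           = noDD s
noDD (D _ ∷ [])        = true
noDD (D _ ∷ U ∷ s)     = noDD (U ∷ s)
noDD (D _ ∷ D _ ∷ s)   = false

isDAP : Path → Bool
isDAP []      = false
isDAP (s ∷ p) = validFrom 0 (s ∷ p) ∧ noDD (s ∷ p)

heightFrom : ℕ → Path → ℕ
heightFrom h []      = h
heightFrom h (s ∷ p) = h ⊔ heightFrom (stepH h s) p

height : Path → ℕ
height = heightFrom 0

firstReturnFrom : ℕ → Path → Path × Path
firstReturnFrom h []      = [] , []
firstReturnFrom h (s ∷ p) =
  if stepH h s ≡ᵇ 0 then (s ∷ [] , p)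
  else map₁ (s ∷_) (firstReturnFrom (stepH h s) p)

firstReturn : Path → Path × Path
firstReturn = firstReturnFrom 0

lowerStep : Step → Step
lowerStep (D (suc m)) = D m
lowerStep s           = s

lowerLast : Path → Path
lowerLast []          = []
lowerLast (s ∷ [])    = lowerStep s ∷ []
lowerLast (s ∷ t ∷ p) = s ∷ lowerLast (t ∷ p)

lowering : Path → Path
lowering []      = []
lowering (_ ∷ p) = lowerLast p

isUD : Path → Bool
isUD (U ∷ D zero ∷ []) = true
isUD _                 = false

-- The fuel argument is only a termination device: both α^♭ and β are
-- strictly shorter than γ, so fuel = length γ is always sufficient.
inHFuel : ℕ → Path → Bool
inHFuel _       []      = true
inHFuel zero    (_ ∷ _) = false
inHFuel (suc f) (s ∷ p) with firstReturn (s ∷ p)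
... | α , β = isDAP (s ∷ p)
            ∧ (isUD α ∨ inHFuel f (lowering α))
            ∧ inHFuel f β
            ∧ (height β ≤ᵇ height α)

inH : Path → Bool
inH γ = inHFuel (length γ) γ

-- Enumeration of all paths of length n (down-steps D_k with k ≤ n suffice,
-- since a step D_k needs height ≥ k ≤ n).

alphabet : ℕ → List Step
alphabet n = U ∷ map D (upTo n)

words : List Step → ℕ → List Path
words A zero    = [] ∷ []
words A (suc n) = concatMap (λ a → map (a ∷_) (words A n)) A

allPaths : ℕ → List Path
allPaths n = words (alphabet n) n

countH : ℕ → ℕ → ℕ
countH k n = length (filterᵇ (λ γ → inH γ ∧ (height γ ≤ᵇ k)) (allPaths n))

Series : Set
Series = ℕ → ℤ

B : ℕ → Series
B k n = + countH k n

_⊕_ : Series → Series → Series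
(f ⊕ g) n = f n ℤ.+ g n

_⊖_ : Series → Series → Series
(f ⊖ g) n = f n ℤ.- g n

sumℤ : List ℤ → ℤ
sumℤ []       = + 0
sumℤ (a ∷ as) = a ℤ.+ sumℤ as

_⊛_ : Series → Series → Series
(f ⊛ g) n = sumℤ (map (λ i → f i ℤ.* g (n ∸ i)) (upTo (suc n)))

X^ : ℕ → Series
X^ m n = if m ≡ᵇ n then + 1 else + 0

one : Series
one = X^ 0

infixl 6 _⊕_ _⊖_
infixl 7 _⊛_

-- Cut a path of ℋ of height exactly k + 1 at its first return: the first factor α is U D or a
-- prime DAP of height k + 1 whose lowering α♭ is a path of ℋ of height exactly k, one step
-- shorter, and every such path arises from exactly one α; the rest is any path of ℋ of height
-- at most k + 1.  Hence B_{k+1} = B_k + x (B_k - B_{k-1}) B_{k+1}, with B_{-1} = 1 - x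
-- accounting for α = U D.  The identity then follows by induction on k: multiplying it by
-- 1 - x B_k + x B_{k-1}, a series with constant term 1 and hence cancellable, reduces the claim
-- for k + 1 to the claim for k.

module Submission where

open import Defs
open import Algebra.Bundles using (CommutativeRing)
import Algebra.Construct.Pointwise as Pointwise
open import Algebra.Solver.Ring.AlmostCommutativeRing using (fromCommutativeRing; _-Raw-AlmostCommutative⟶_)
open import Data.Bool using (Bool; true; false; T; not; _∧_; _∨_; if_then_else_)
import Data.Bool.Properties as Boolₚ
open import Data.Empty using (⊥-elim)
open import Data.Integer as ℤ using (ℤ; +_; _+_; _*_; -_)
import Data.Integer.Properties as ℤₚ
open import Data.List using (List; []; _∷_; _++_; map; length; take; upTo; applyUpTo; concatMap; filterᵇ)
import Data.List.Properties as Listₚ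
open import Data.List.Relation.Unary.All using (All; []; _∷_)
open import Data.Maybe using (Maybe; just; nothing)
open import Data.Nat as ℕ using (ℕ; zero; suc; _∸_; _≤_; _<_; z≤n; s≤s; _⊔_; _≡ᵇ_; _≤ᵇ_)
open import Data.Nat.Induction using (<-rec)
import Data.Nat.Properties as ℕₚ
open import Data.Product using (Σ; _×_; _,_; proj₁; proj₂; map₁)
open import Function using (id; _∘_; _⟨_⟩_)
open import Function.Bundles using (Equivalence)
open import Level using (0ℓ)
open import Relation.Nullary using (¬_; yes; no)
open import Relation.Binary.PropositionalEquality

open import Algebra.Properties.AbelianGroup ℤₚ.+-0-abelianGroup using (xyx⁻¹≈y)
open import Algebra.Properties.CommutativeSemigroup ℤₚ.+-commutativeSemigroup using (interchange)

-- Finite sums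

∑ : ℕ → (ℕ → ℤ) → ℤ
∑ zero    f = + 0
∑ (suc n) f = f 0 + ∑ n (f ∘ suc)

sumℤ-applyUpTo : ∀ n (f : ℕ → ℤ) (g : ℕ → ℕ) → sumℤ (map f (applyUpTo g n)) ≡ ∑ n (f ∘ g)
sumℤ-applyUpTo zero    f g = refl
sumℤ-applyUpTo (suc n) f g = cong (_+_ (f (g 0))) (sumℤ-applyUpTo n f (g ∘ suc))

∑-cong : ∀ n {f g : ℕ → ℤ} → (∀ i → i < n → f i ≡ g i) → ∑ n f ≡ ∑ n g
∑-cong zero    f≡g = refl
∑-cong (suc n) f≡g = cong₂ _+_ (f≡g 0 (s≤s z≤n)) (∑-cong n (λ i i<n → f≡g (suc i) (s≤s i<n)))

∑-zero : ∀ n → ∑ n (λ _ → + 0) ≡ + 0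
∑-zero zero    = refl
∑-zero (suc n) = trans (ℤₚ.+-identityˡ _) (∑-zero n)

∑-vanish : ∀ n {f : ℕ → ℤ} → (∀ i → i < n → f i ≡ + 0) → ∑ n f ≡ + 0
∑-vanish n f≡0 = trans (∑-cong n f≡0) (∑-zero n)

∑-distrib-+ : ∀ n (f g : ℕ → ℤ) → ∑ n (λ i → f i + g i) ≡ ∑ n f + ∑ n g
∑-distrib-+ zero    f g = refl
∑-distrib-+ (suc n) f g = trans (cong (_+_ (f 0 + g 0)) (∑-distrib-+ n (f ∘ suc) (g ∘ suc)))
                                (interchange (f 0) (g 0) _ _)

∑-*ˡ : ∀ n c (f : ℕ → ℤ) → ∑ n (λ i → c * f i) ≡ c * ∑ n f
∑-*ˡ zero    c f = sym (ℤₚ.*-zeroʳ c)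
∑-*ˡ (suc n) c f = trans (cong (_+_ (c * f 0)) (∑-*ˡ n c (f ∘ suc)))
                         (sym (ℤₚ.*-distribˡ-+ c (f 0) _))

∑-*ʳ : ∀ n c (f : ℕ → ℤ) → ∑ n (λ i → f i * c) ≡ ∑ n f * c
∑-*ʳ n c f = trans (∑-cong n (λ i _ → ℤₚ.*-comm (f i) c))
                   (trans (∑-*ˡ n c f) (ℤₚ.*-comm c _))

∑-init-last : ∀ n (f : ℕ → ℤ) → ∑ (suc n) f ≡ ∑ n f + f n
∑-init-last zero    f = ℤₚ.+-comm (f 0) (+ 0)
∑-init-last (suc n) f = trans (cong (_+_ (f 0)) (∑-init-last n (f ∘ suc)))
                              (sym (ℤₚ.+-assoc (f 0) _ _))

∑-split : ∀ m n (f : ℕ → ℤ) → ∑ (m ℕ.+ n) f ≡ ∑ m f + ∑ n (λ i → f (m ℕ.+ i))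
∑-split zero    n f = sym (ℤₚ.+-identityˡ _)
∑-split (suc m) n f = trans (cong (_+_ (f 0)) (∑-split m n (f ∘ suc)))
                            (sym (ℤₚ.+-assoc (f 0) _ _))

∑-reverse : ∀ n (f : ℕ → ℤ) → ∑ n f ≡ ∑ n (λ i → f (n ∸ suc i))
∑-reverse zero    f = refl
∑-reverse (suc n) f = begin
  f 0 + ∑ n (f ∘ suc)                         ≡⟨ cong (_+_ (f 0)) (∑-reverse n (f ∘ suc)) ⟩
  f 0 + ∑ n (λ i → f (suc (n ∸ suc i)))       ≡⟨ ℤₚ.+-comm (f 0) _ ⟩
  ∑ n (λ i → f (suc (n ∸ suc i))) + f 0       ≡⟨ cong₂ _+_ (∑-cong n (λ i i<n → cong f (sym (ℕₚ.+-∸-assoc 1 i<n))))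
                                                            (cong f (sym (ℕₚ.n∸n≡0 n))) ⟩
  ∑ n (λ i → f (n ∸ i)) + f (n ∸ n)           ≡⟨ ∑-init-last n (λ i → f (n ∸ i)) ⟨
  ∑ (suc n) (λ i → f (n ∸ i))                 ∎
  where open ≡-Reasoning

∑-triangle : ∀ n (t : ℕ → ℕ → ℤ) →
  ∑ n (λ i → ∑ (suc i) (λ j → t j i)) ≡ ∑ n (λ j → ∑ (n ∸ j) (λ l → t j (j ℕ.+ l)))
∑-triangle zero    t = refl
∑-triangle (suc n) t = begin
  ∑ (suc n) (λ i → ∑ (suc i) (λ j → t j i))          ≡⟨ ∑-init-last n _ ⟩
  ∑ n (λ i → ∑ (suc i) (λ j → t j i)) + column n      ≡⟨ cong (_+ column n) (∑-triangle n t) ⟩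
  ∑ n row + column n                                  ≡⟨ cong (_+ column n) row-extend ⟩
  ∑ (suc n) row + column n                            ≡⟨ ∑-distrib-+ (suc n) row (λ j → t j n) ⟨
  ∑ (suc n) (λ j → row j + t j n)                     ≡⟨ ∑-cong (suc n) (λ j j≤n → row-snoc j (ℕₚ.≤-pred j≤n)) ⟩
  ∑ (suc n) (λ j → ∑ (suc n ∸ j) (λ l → t j (j ℕ.+ l))) ∎
  where
  open ≡-Reasoning
  row : ℕ → ℤ
  row j = ∑ (n ∸ j) (λ l → t j (j ℕ.+ l))
  column : ℕ → ℤ
  column i = ∑ (suc i) (λ j → t j i)
  row-extend : ∑ n row ≡ ∑ (suc n) row
  row-extend = sym (begin
    ∑ (suc n) row         ≡⟨ ∑-init-last n row ⟩
    ∑ n row + row n       ≡⟨ cong (λ m → ∑ n row + ∑ m (λ l → t n (n ℕ.+ l))) (ℕₚ.n∸n≡0 n) ⟩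
    ∑ n row + + 0         ≡⟨ ℤₚ.+-identityʳ _ ⟩
    ∑ n row               ∎)
  row-snoc : ∀ j → j ℕ.≤ n → row j + t j n ≡ ∑ (suc n ∸ j) (λ l → t j (j ℕ.+ l))
  row-snoc j j≤n = begin
    row j + t j n                          ≡⟨ cong (λ i → row j + t j i) (ℕₚ.m+[n∸m]≡n j≤n) ⟨
    row j + t j (j ℕ.+ (n ∸ j))            ≡⟨ ∑-init-last (n ∸ j) (λ l → t j (j ℕ.+ l)) ⟨
    ∑ (suc (n ∸ j)) (λ l → t j (j ℕ.+ l))   ≡⟨ cong (λ m → ∑ m (λ l → t j (j ℕ.+ l))) (ℕₚ.+-∸-assoc 1 j≤n) ⟨
    ∑ (suc n ∸ j) (λ l → t j (j ℕ.+ l))     ∎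

-- The ring of formal power series

⊛-coeff : ∀ f g n → (f ⊛ g) n ≡ ∑ (suc n) (λ i → f i * g (n ∸ i))
⊛-coeff f g n = sumℤ-applyUpTo (suc n) (λ i → f i * g (n ∸ i)) id

⊛-cong : ∀ {f f′ g g′} → f ≗ f′ → g ≗ g′ → f ⊛ g ≗ f′ ⊛ g′
⊛-cong {f} {f′} {g} {g′} f≗f′ g≗g′ n = begin
  (f ⊛ g) n                              ≡⟨ ⊛-coeff f g n ⟩
  ∑ (suc n) (λ i → f i * g (n ∸ i))      ≡⟨ ∑-cong (suc n) (λ i _ → cong₂ _*_ (f≗f′ i) (g≗g′ (n ∸ i))) ⟩
  ∑ (suc n) (λ i → f′ i * g′ (n ∸ i))    ≡⟨ ⊛-coeff f′ g′ n ⟨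
  (f′ ⊛ g′) n                            ∎
  where open ≡-Reasoning

⊛-comm : ∀ f g → f ⊛ g ≗ g ⊛ f
⊛-comm f g n = begin
  (f ⊛ g) n                                         ≡⟨ ⊛-coeff f g n ⟩
  ∑ (suc n) (λ i → f i * g (n ∸ i))                 ≡⟨ ∑-reverse (suc n) (λ i → f i * g (n ∸ i)) ⟩
  ∑ (suc n) (λ i → f (n ∸ i) * g (n ∸ (n ∸ i)))     ≡⟨ ∑-cong (suc n) swap ⟩
  ∑ (suc n) (λ i → g i * f (n ∸ i))                 ≡⟨ ⊛-coeff g f n ⟨
  (g ⊛ f) n                                         ∎
  where
  open ≡-Reasoning
  swap : ∀ i → i < suc n → f (n ∸ i) * g (n ∸ (n ∸ i)) ≡ g i * f (n ∸ i)
  swap i i<1+n = trans (ℤₚ.*-comm (f (n ∸ i)) _)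
                       (cong (λ j → g j * f (n ∸ i)) (ℕₚ.m∸[m∸n]≡n (ℕₚ.≤-pred i<1+n)))

⊛-assoc : ∀ f g h → (f ⊛ g) ⊛ h ≗ f ⊛ (g ⊛ h)
⊛-assoc f g h n = begin
  ((f ⊛ g) ⊛ h) n
    ≡⟨ ⊛-coeff (f ⊛ g) h n ⟩
  ∑ (suc n) (λ i → (f ⊛ g) i * h (n ∸ i))
    ≡⟨ ∑-cong (suc n) (λ i _ → expand i) ⟩
  ∑ (suc n) (λ i → ∑ (suc i) (λ j → t j i))
    ≡⟨ ∑-triangle (suc n) t ⟩
  ∑ (suc n) (λ j → ∑ (suc n ∸ j) (λ l → t j (j ℕ.+ l)))
    ≡⟨ ∑-cong (suc n) (λ j j<1+n → collect j (ℕₚ.≤-pred j<1+n)) ⟩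
  ∑ (suc n) (λ j → f j * (g ⊛ h) (n ∸ j))
    ≡⟨ ⊛-coeff f (g ⊛ h) n ⟨
  (f ⊛ (g ⊛ h)) n ∎
  where
  open ≡-Reasoning
  t : ℕ → ℕ → ℤ
  t j i = f j * g (i ∸ j) * h (n ∸ i)
  expand : ∀ i → (f ⊛ g) i * h (n ∸ i) ≡ ∑ (suc i) (λ j → t j i)
  expand i = trans (cong (_* h (n ∸ i)) (⊛-coeff f g i))
                   (sym (∑-*ʳ (suc i) (h (n ∸ i)) (λ j → f j * g (i ∸ j))))
  collect : ∀ j → j ℕ.≤ n → ∑ (suc n ∸ j) (λ l → t j (j ℕ.+ l)) ≡ f j * (g ⊛ h) (n ∸ j)
  collect j j≤n = begin
    ∑ (suc n ∸ j) (λ l → t j (j ℕ.+ l))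
      ≡⟨ cong (λ m → ∑ m (λ l → t j (j ℕ.+ l))) (ℕₚ.+-∸-assoc 1 j≤n) ⟩
    ∑ (suc (n ∸ j)) (λ l → t j (j ℕ.+ l))
      ≡⟨ ∑-cong (suc (n ∸ j)) (λ l _ → trans (ℤₚ.*-assoc (f j) (g (j ℕ.+ l ∸ j)) (h (n ∸ (j ℕ.+ l))))
           (cong₂ (λ a b → f j * (g a * h b)) (ℕₚ.m+n∸m≡n j l) (sym (ℕₚ.∸-+-assoc n j l)))) ⟩
    ∑ (suc (n ∸ j)) (λ l → f j * (g l * h (n ∸ j ∸ l)))
      ≡⟨ ∑-*ˡ (suc (n ∸ j)) (f j) (λ l → g l * h (n ∸ j ∸ l)) ⟩
    f j * ∑ (suc (n ∸ j)) (λ l → g l * h (n ∸ j ∸ l))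
      ≡⟨ cong (f j *_) (⊛-coeff g h (n ∸ j)) ⟨
    f j * (g ⊛ h) (n ∸ j) ∎

⊛-distribˡ-⊕ : ∀ f g h → f ⊛ (g ⊕ h) ≗ f ⊛ g ⊕ f ⊛ h
⊛-distribˡ-⊕ f g h n = begin
  (f ⊛ (g ⊕ h)) n
    ≡⟨ ⊛-coeff f (g ⊕ h) n ⟩
  ∑ (suc n) (λ i → f i * (g (n ∸ i) + h (n ∸ i)))
    ≡⟨ ∑-cong (suc n) (λ i _ → ℤₚ.*-distribˡ-+ (f i) (g (n ∸ i)) (h (n ∸ i))) ⟩
  ∑ (suc n) (λ i → f i * g (n ∸ i) + f i * h (n ∸ i))
    ≡⟨ ∑-distrib-+ (suc n) (λ i → f i * g (n ∸ i)) (λ i → f i * h (n ∸ i)) ⟩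
  ∑ (suc n) (λ i → f i * g (n ∸ i)) + ∑ (suc n) (λ i → f i * h (n ∸ i))
    ≡⟨ cong₂ _+_ (⊛-coeff f g n) (⊛-coeff f h n) ⟨
  (f ⊛ g ⊕ f ⊛ h) n ∎
  where open ≡-Reasoning

⊛-identityˡ : ∀ f → one ⊛ f ≗ f
⊛-identityˡ f n = begin
  (one ⊛ f) n                                          ≡⟨ ⊛-coeff one f n ⟩
  + 1 * f n + ∑ n (λ i → + 0 * f (n ∸ suc i))          ≡⟨ cong₂ _+_ (ℤₚ.*-identityˡ (f n)) (∑-zero n) ⟩
  f n + + 0                                            ≡⟨ ℤₚ.+-identityʳ (f n) ⟩
  f n                                                  ∎
  where open ≡-Reasoning

seriesRing : CommutativeRing 0ℓ 0ℓ
seriesRing = record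
  { Carrier           = Series
  ; _≈_               = _≗_
  ; _+_               = _⊕_
  ; _*_               = _⊛_
  ; -_                = λ f n → - f n
  ; 0#                = λ _ → + 0
  ; 1#                = one
  ; isCommutativeRing = record
    { isRing = record
      { +-isAbelianGroup = Pointwise.isAbelianGroup ℕ ℤₚ.+-0-isAbelianGroup
      ; *-cong           = ⊛-cong
      ; *-assoc          = ⊛-assoc
      ; *-identity       = ⊛-identityˡ , λ f n → trans (⊛-comm f one n) (⊛-identityˡ f n)
      ; distrib          = ⊛-distribˡ-⊕ , λ f g h n → trans (⊛-comm (g ⊕ h) f n)
                             (trans (⊛-distribˡ-⊕ f g h n) (cong₂ _+_ (⊛-comm f g n) (⊛-comm f h n)))
      }
    ; *-comm = ⊛-comm
    }
  }

-- Written like X^ 0, so that constant (+ 1) and one are definitionally equal.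
constant : ℤ → Series
constant c n = if 0 ≡ᵇ n then c else + 0

constant-⊛ : ∀ c f → constant c ⊛ f ≗ λ n → c * f n
constant-⊛ c f n = trans (⊛-coeff (constant c) f n)
                         (trans (cong (_+_ (c * f n)) (∑-zero n)) (ℤₚ.+-identityʳ (c * f n)))

constant-homomorphism : CommutativeRing.rawRing ℤₚ.+-*-commutativeRing
                          -Raw-AlmostCommutative⟶ fromCommutativeRing seriesRing
constant-homomorphism = record
  { ⟦_⟧    = constant
  ; +-homo = λ { a b zero → refl ; a b (suc n) → refl }
  ; *-homo = λ { a b zero → sym (constant-⊛ a (constant b) zero)
               ; a b (suc n) → sym (trans (constant-⊛ a (constant b) (suc n)) (ℤₚ.*-zeroʳ a)) }
  ; -‿homo = λ { a zero → refl ; a (suc n) → refl }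
  ; 0-homo = λ { zero → refl ; (suc n) → refl }
  ; 1-homo = λ { zero → refl ; (suc n) → refl }
  }

constant-≟ : ∀ a b → Maybe (constant a ≗ constant b)
constant-≟ a b with a ℤ.≟ b
... | yes refl = just (λ _ → refl)
... | no _     = nothing

open import Algebra.Solver.Ring _ _ constant-homomorphism constant-≟ using (solve; _:=_; con; _:+_; _:-_; _:*_)
open CommutativeRing seriesRing using (+-cong; *-cong; -‿cong)
  renaming (setoid to seriesSetoid; refl to ≗-refl; sym to ≗-sym; trans to ≗-trans; 0# to 0ₛ)
open import Algebra.Properties.Group (CommutativeRing.+-group seriesRing) using (x∙y⁻¹≈ε⇒x≈y; x≈y⇒x∙y⁻¹≈ε)

⊛≗0⇒≗0 : ∀ d e → d 0 ≡ + 1 → d ⊛ e ≗ 0ₛ → e ≗ 0ₛ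
⊛≗0⇒≗0 d e d₀≡1 de≗0 = <-rec (λ n → e n ≡ + 0) step
  where
  step : ∀ n → (∀ {m} → m < n → e m ≡ + 0) → e n ≡ + 0
  step n ih = begin
    e n                                              ≡⟨ ℤₚ.*-identityˡ (e n) ⟨
    + 1 * e n                                        ≡⟨ cong (_* e n) d₀≡1 ⟨
    d 0 * e n                                        ≡⟨ ℤₚ.+-identityʳ _ ⟨
    d 0 * e n + + 0                                  ≡⟨ cong (_+_ (d 0 * e n)) tail≡0 ⟨
    d 0 * e n + ∑ n (λ i → d (suc i) * e (n ∸ suc i)) ≡⟨ ⊛-coeff d e n ⟨
    (d ⊛ e) n                                        ≡⟨ de≗0 n ⟩
    + 0                                              ∎
    where
    open ≡-Reasoning
    tail≡0 : ∑ n (λ i → d (suc i) * e (n ∸ suc i)) ≡ + 0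
    tail≡0 = ∑-vanish n (λ { i (s≤s i<n) → trans (cong (d (suc i) *_) (ih (s≤s (ℕₚ.m∸n≤m _ i))))
                                                 (ℤₚ.*-zeroʳ (d (suc i))) })

-- The functional equation

X : Series
X = X^ 1

X⊛-shift : ∀ f n → (X ⊛ f) (suc n) ≡ f n
X⊛-shift f n = begin
  (X ⊛ f) (suc n)
    ≡⟨ ⊛-coeff X f (suc n) ⟩
  + 0 * f (suc n) + (+ 1 * f n + ∑ n (λ i → + 0 * f (n ∸ suc i)))
    ≡⟨ cong (_+_ (+ 0 * f (suc n))) (cong₂ _+_ (ℤₚ.*-identityˡ (f n)) (∑-zero n)) ⟩
  + 0 * f (suc n) + (f n + + 0)
    ≡⟨ trans (ℤₚ.+-identityˡ _) (ℤₚ.+-identityʳ (f n)) ⟩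
  f n ∎
  where open ≡-Reasoning

X^-suc : ∀ m → X^ (suc m) ≗ X ⊛ X^ m
X^-suc m zero    = refl
X^-suc m (suc n) = sym (X⊛-shift (X^ m) n)

-- Powers of x are written as products so that the ring solver sees through them.
Consecutive : Series → Series → Set
Consecutive b a = b ⊛ (X ⊛ X ⊛ a ⊕ X) ≗ (one ⊖ X ⊛ (X ⊛ X) ⊕ X) ⊛ a ⊖ one

Consecutive-congʳ : ∀ {b a a′} → a ≗ a′ → Consecutive b a → Consecutive b a′
Consecutive-congʳ {b} {a} {a′} a≗a′ rel = begin
  b ⊛ (X ⊛ X ⊛ a′ ⊕ X)                   ≈⟨ *-cong (≗-refl {b}) (+-cong (*-cong (≗-refl {X ⊛ X}) a≗a′) (≗-refl {X})) ⟨
  b ⊛ (X ⊛ X ⊛ a ⊕ X)                    ≈⟨ rel ⟩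
  (one ⊖ X ⊛ (X ⊛ X) ⊕ X) ⊛ a ⊖ one      ≈⟨ +-cong (*-cong (≗-refl {one ⊖ X ⊛ (X ⊛ X) ⊕ X}) a≗a′) (≗-refl {λ n → - one n}) ⟩
  (one ⊖ X ⊛ (X ⊛ X) ⊕ X) ⊛ a′ ⊖ one     ∎
  where open import Relation.Binary.Reasoning.Setoid seriesSetoid

consecutive-base : Consecutive (one ⊖ X) one
consecutive-base = solve 1 (λ x → (con (+ 1) :- x) :* (x :* x :* con (+ 1) :+ x)
                                   := (con (+ 1) :- x :* (x :* x) :+ x) :* con (+ 1) :- con (+ 1))
                           (λ _ → refl) X

⊛-factor-recurrence : ∀ {p a c} → c ≗ a ⊕ X ⊛ (a ⊖ p) ⊛ c → c ⊛ (one ⊖ X ⊛ a ⊕ X ⊛ p) ≗ a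
⊛-factor-recurrence {p} {a} {c} rec = begin
  c ⊛ (one ⊖ X ⊛ a ⊕ X ⊛ p)
    ≈⟨ solve 4 (λ a p c x → c :* (con (+ 1) :- x :* a :+ x :* p) := c :- x :* (a :- p) :* c) (λ _ → refl) a p c X ⟩
  c ⊖ X ⊛ (a ⊖ p) ⊛ c
    ≈⟨ +-cong rec (≗-refl {λ n → - (X ⊛ (a ⊖ p) ⊛ c) n}) ⟩
  a ⊕ X ⊛ (a ⊖ p) ⊛ c ⊖ X ⊛ (a ⊖ p) ⊛ c
    ≈⟨ solve 2 (λ a t → a :+ t :- t := a) (λ _ → refl) a (X ⊛ (a ⊖ p) ⊛ c) ⟩
  a ∎
  where open import Relation.Binary.Reasoning.Setoid seriesSetoid

-- With δ = 1 - x a + x p the recurrence gives c δ = a, which turns δ times the claim for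
-- (a, c) into the claim for (p, a).
consecutive-step : ∀ {p a c} → Consecutive p a → c ≗ a ⊕ X ⊛ (a ⊖ p) ⊛ c → Consecutive a c
consecutive-step {p} {a} {c} rel rec = x∙y⁻¹≈ε⇒x≈y L R (⊛≗0⇒≗0 δ (L ⊖ R) refl (begin
  δ ⊛ (L ⊖ R)
    ≈⟨ solve 4 (λ a p c x →
         (con (+ 1) :- x :* a :+ x :* p) :* (a :* (x :* x :* c :+ x) :- ((con (+ 1) :- x :* (x :* x) :+ x) :* c :- con (+ 1)))
         := a :* (x :* x :* (c :* (con (+ 1) :- x :* a :+ x :* p)) :+ x :* (con (+ 1) :- x :* a :+ x :* p))
            :- ((con (+ 1) :- x :* (x :* x) :+ x) :* (c :* (con (+ 1) :- x :* a :+ x :* p)) :- (con (+ 1) :- x :* a :+ x :* p)))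
        (λ _ → refl) a p c X ⟩
  F (c ⊛ δ)
    ≈⟨ F-cong (⊛-factor-recurrence {p} {a} {c} rec) ⟩
  F a
    ≈⟨ solve 3 (λ a p x →
         a :* (x :* x :* a :+ x :* (con (+ 1) :- x :* a :+ x :* p)) :- ((con (+ 1) :- x :* (x :* x) :+ x) :* a :- (con (+ 1) :- x :* a :+ x :* p))
         := p :* (x :* x :* a :+ x) :- ((con (+ 1) :- x :* (x :* x) :+ x) :* a :- con (+ 1)))
        (λ _ → refl) a p X ⟩
  p ⊛ (X ⊛ X ⊛ a ⊕ X) ⊖ ((one ⊖ X ⊛ (X ⊛ X) ⊕ X) ⊛ a ⊖ one)
    ≈⟨ x≈y⇒x∙y⁻¹≈ε rel ⟩
  0ₛ ∎))
  where
  open import Relation.Binary.Reasoning.Setoid seriesSetoid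
  δ L R : Series
  δ = one ⊖ X ⊛ a ⊕ X ⊛ p
  L = a ⊛ (X ⊛ X ⊛ c ⊕ X)
  R = (one ⊖ X ⊛ (X ⊛ X) ⊕ X) ⊛ c ⊖ one
  F : Series → Series
  F y = a ⊛ (X ⊛ X ⊛ y ⊕ X ⊛ δ) ⊖ ((one ⊖ X ⊛ (X ⊛ X) ⊕ X) ⊛ y ⊖ δ)
  F-cong : ∀ {y z} → y ≗ z → F y ≗ F z
  F-cong y≗z = +-cong (*-cong (≗-refl {a}) (+-cong (*-cong (≗-refl {X ⊛ X}) y≗z) (≗-refl {X ⊛ δ})))
                      (-‿cong (+-cong (*-cong (≗-refl {one ⊖ X ⊛ (X ⊛ X) ⊕ X}) y≗z) (≗-refl {λ n → - δ n})))

Consecutive⇒monomials : ∀ {b a} → Consecutive b a →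
  b ⊛ (X^ 2 ⊛ a ⊕ X^ 1) ≗ (one ⊖ X^ 3 ⊕ X^ 1) ⊛ a ⊖ one
Consecutive⇒monomials {b} {a} rel = begin
  b ⊛ (X^ 2 ⊛ a ⊕ X)                  ≈⟨ *-cong (≗-refl {b}) (+-cong (*-cong X²≗ (≗-refl {a})) (≗-refl {X})) ⟩
  b ⊛ (X ⊛ X ⊛ a ⊕ X)                 ≈⟨ rel ⟩
  (one ⊖ X ⊛ (X ⊛ X) ⊕ X) ⊛ a ⊖ one   ≈⟨ +-cong (*-cong (+-cong (+-cong (≗-refl {one}) (-‿cong (≗-sym X³≗))) (≗-refl {X}))
                                                         (≗-refl {a})) (≗-refl {λ n → - one n}) ⟩
  (one ⊖ X^ 3 ⊕ X) ⊛ a ⊖ one          ∎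
  where
  open import Relation.Binary.Reasoning.Setoid seriesSetoid
  X²≗ : X^ 2 ≗ X ⊛ X
  X²≗ = X^-suc 1
  X³≗ : X^ 3 ≗ X ⊛ (X ⊛ X)
  X³≗ = ≗-trans {X^ 3} (X^-suc 2) (*-cong (≗-refl {X}) X²≗)

-- Sums over words

χ : Bool → ℤ
χ true  = + 1
χ false = + 0

∑Paths : ℕ → ℕ → (Path → ℤ) → ℤ
∑Paths M zero    f = f []
∑Paths M (suc n) f = ∑Paths M n (f ∘ (U ∷_)) + ∑ M (λ m → ∑Paths M n (f ∘ (D m ∷_)))

χ-false-* : ∀ {b} x → b ≡ false → χ b * x ≡ + 0
χ-false-* x refl = refl

*-χ-false : ∀ x {b} → b ≡ false → x * χ b ≡ + 0
*-χ-false x refl = ℤₚ.*-zeroʳ x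

count : (Path → Bool) → List Path → ℤ
count p ws = + length (filterᵇ p ws)

count-∷ : ∀ p w ws → count p (w ∷ ws) ≡ χ (p w) + count p ws
count-∷ p w ws with p w
... | true  = refl
... | false = sym (ℤₚ.+-identityˡ _)

count-++ : ∀ p us vs → count p (us ++ vs) ≡ count p us + count p vs
count-++ p []       vs = sym (ℤₚ.+-identityˡ _)
count-++ p (u ∷ us) vs = begin
  count p (u ∷ us ++ vs)               ≡⟨ count-∷ p u (us ++ vs) ⟩
  χ (p u) + count p (us ++ vs)         ≡⟨ cong (_+_ (χ (p u))) (count-++ p us vs) ⟩
  χ (p u) + (count p us + count p vs)  ≡⟨ ℤₚ.+-assoc (χ (p u)) _ _ ⟨
  χ (p u) + count p us + count p vs    ≡⟨ cong (_+ count p vs) (count-∷ p u us) ⟨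
  count p (u ∷ us) + count p vs        ∎
  where open ≡-Reasoning

count-map : ∀ p (g : Path → Path) ws → count p (map g ws) ≡ count (p ∘ g) ws
count-map p g []       = refl
count-map p g (w ∷ ws) = trans (count-∷ p (g w) (map g ws))
  (trans (cong (_+_ (χ (p (g w)))) (count-map p g ws)) (sym (count-∷ (p ∘ g) w ws)))

count-concatMap : ∀ p (g : Step → List Path) (A : List Step) →
  count p (concatMap g A) ≡ sumℤ (map (count p ∘ g) A)
count-concatMap p g []      = refl
count-concatMap p g (a ∷ A) = trans (count-++ p (g a) (concatMap g A))
                                    (cong (_+_ (count p (g a))) (count-concatMap p g A))

count-words : ∀ M n p → count p (words (alphabet M) n) ≡ ∑Paths M n (χ ∘ p)
count-words M zero    p = trans (count-∷ p [] []) (ℤₚ.+-identityʳ _)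
count-words M (suc n) p = begin
  count p (concatMap extend (alphabet M))
    ≡⟨ count-concatMap p extend (alphabet M) ⟩
  count p (extend U) + sumℤ (map (count p ∘ extend) (map D (upTo M)))
    ≡⟨ cong (λ s → count p (extend U) + sumℤ s) (Listₚ.map-∘ (upTo M)) ⟨
  count p (extend U) + sumℤ (map (count p ∘ extend ∘ D) (upTo M))
    ≡⟨ cong (_+_ (count p (extend U))) (sumℤ-applyUpTo M (count p ∘ extend ∘ D) id) ⟩
  count p (extend U) + ∑ M (count p ∘ extend ∘ D)
    ≡⟨ cong₂ _+_ (extend-words U) (∑-cong M (λ m _ → extend-words (D m))) ⟩
  ∑Paths M (suc n) (χ ∘ p) ∎
  where
  open ≡-Reasoning
  extend : Step → List Path
  extend a = map (a ∷_) (words (alphabet M) n)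
  extend-words : ∀ a → count p (extend a) ≡ ∑Paths M n (χ ∘ p ∘ (a ∷_))
  extend-words a = trans (count-map p (a ∷_) (words (alphabet M) n)) (count-words M n (p ∘ (a ∷_)))

∑Paths-cong : ∀ M n {f g : Path → ℤ} → (∀ w → length w ≡ n → f w ≡ g w) → ∑Paths M n f ≡ ∑Paths M n g
∑Paths-cong M zero    f≡g = f≡g [] refl
∑Paths-cong M (suc n) f≡g =
  cong₂ _+_ (∑Paths-cong M n (λ w |w| → f≡g (U ∷ w) (cong suc |w|)))
            (∑-cong M (λ m _ → ∑Paths-cong M n (λ w |w| → f≡g (D m ∷ w) (cong suc |w|))))

∑Paths-vanish : ∀ M n {f : Path → ℤ} → (∀ w → length w ≡ n → f w ≡ + 0) → ∑Paths M n f ≡ + 0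
∑Paths-vanish M zero    f≡0 = f≡0 [] refl
∑Paths-vanish M (suc n) f≡0 =
  cong₂ _+_ (∑Paths-vanish M n (λ w |w| → f≡0 (U ∷ w) (cong suc |w|)))
            (∑-vanish M (λ m _ → ∑Paths-vanish M n (λ w |w| → f≡0 (D m ∷ w) (cong suc |w|))))

∑Paths-distrib-+ : ∀ M n (f g : Path → ℤ) → ∑Paths M n (λ w → f w + g w) ≡ ∑Paths M n f + ∑Paths M n g
∑Paths-distrib-+ M zero    f g = refl
∑Paths-distrib-+ M (suc n) f g = begin
  ∑Paths M n (λ w → f (U ∷ w) + g (U ∷ w)) + ∑ M (λ m → ∑Paths M n (λ w → f (D m ∷ w) + g (D m ∷ w)))
    ≡⟨ cong₂ _+_ (∑Paths-distrib-+ M n (f ∘ (U ∷_)) (g ∘ (U ∷_)))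
                 (trans (∑-cong M (λ m _ → ∑Paths-distrib-+ M n (f ∘ (D m ∷_)) (g ∘ (D m ∷_))))
                        (∑-distrib-+ M _ _)) ⟩
  (∑Paths M n (f ∘ (U ∷_)) + ∑Paths M n (g ∘ (U ∷_))) + (fD + gD)
    ≡⟨ interchange (∑Paths M n (f ∘ (U ∷_))) _ fD gD ⟩
  ∑Paths M (suc n) f + ∑Paths M (suc n) g ∎
  where
  open ≡-Reasoning
  fD gD : ℤ
  fD = ∑ M (λ m → ∑Paths M n (f ∘ (D m ∷_)))
  gD = ∑ M (λ m → ∑Paths M n (g ∘ (D m ∷_)))

∑Paths-*ˡ : ∀ M n c (f : Path → ℤ) → ∑Paths M n (λ w → c * f w) ≡ c * ∑Paths M n f
∑Paths-*ˡ M zero    c f = refl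
∑Paths-*ˡ M (suc n) c f =
  trans (cong₂ _+_ (∑Paths-*ˡ M n c (f ∘ (U ∷_)))
                   (trans (∑-cong M (λ m _ → ∑Paths-*ˡ M n c (f ∘ (D m ∷_)))) (∑-*ˡ M c _)))
        (sym (ℤₚ.*-distribˡ-+ c _ _))

∑Paths-*ʳ : ∀ M n c (f : Path → ℤ) → ∑Paths M n (λ w → f w * c) ≡ ∑Paths M n f * c
∑Paths-*ʳ M n c f = trans (∑Paths-cong M n (λ w _ → ℤₚ.*-comm (f w) c))
                          (trans (∑Paths-*ˡ M n c f) (ℤₚ.*-comm c _))

∑Paths-∑ : ∀ M n k (f : ℕ → Path → ℤ) → ∑Paths M n (λ w → ∑ k (λ i → f i w)) ≡ ∑ k (λ i → ∑Paths M n (f i))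
∑Paths-∑ M n zero    f = ∑Paths-vanish M n (λ _ _ → refl)
∑Paths-∑ M n (suc k) f = trans (∑Paths-distrib-+ M n (f 0) (λ w → ∑ k (λ i → f (suc i) w)))
                               (cong (_+_ (∑Paths M n (f 0))) (∑Paths-∑ M n k (f ∘ suc)))

∑Paths-++ : ∀ M i j (f : Path → ℤ) → ∑Paths M (i ℕ.+ j) f ≡ ∑Paths M i (λ u → ∑Paths M j (λ v → f (u ++ v)))
∑Paths-++ M zero    j f = refl
∑Paths-++ M (suc i) j f = cong₂ _+_ (∑Paths-++ M i j (f ∘ (U ∷_)))
                                    (∑-cong M (λ m _ → ∑Paths-++ M i j (f ∘ (D m ∷_))))

data InAlphabet (M : ℕ) : Step → Set where
  up   : InAlphabet M U
  down : ∀ {m} → m < M → InAlphabet M (D m)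

∑Paths-alphabet-+ : ∀ M d n (f : Path → ℤ) → (∀ w → length w ≡ n → ¬ All (InAlphabet M) w → f w ≡ + 0) →
  ∑Paths (M ℕ.+ d) n f ≡ ∑Paths M n f
∑Paths-alphabet-+ M d zero    f f≡0 = refl
∑Paths-alphabet-+ M d (suc n) f f≡0 = cong₂ _+_
  (∑Paths-alphabet-+ M d n (f ∘ (U ∷_)) (f≡0-tail U))
  (begin
    ∑ (M ℕ.+ d) (λ m → ∑Paths (M ℕ.+ d) n (f ∘ (D m ∷_)))
      ≡⟨ ∑-split M d _ ⟩
    ∑ M (λ m → ∑Paths (M ℕ.+ d) n (f ∘ (D m ∷_))) + ∑ d (λ i → ∑Paths (M ℕ.+ d) n (f ∘ (D (M ℕ.+ i) ∷_)))
      ≡⟨ cong₂ _+_ (∑-cong M (λ m _ → ∑Paths-alphabet-+ M d n (f ∘ (D m ∷_)) (f≡0-tail (D m)))) (∑-vanish d large) ⟩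
    ∑ M (λ m → ∑Paths M n (f ∘ (D m ∷_))) + + 0
      ≡⟨ ℤₚ.+-identityʳ _ ⟩
    ∑ M (λ m → ∑Paths M n (f ∘ (D m ∷_))) ∎)
  where
  open ≡-Reasoning
  f≡0-tail : ∀ s w → length w ≡ n → ¬ All (InAlphabet M) w → f (s ∷ w) ≡ + 0
  f≡0-tail s w |w| ∉ = f≡0 (s ∷ w) (cong suc |w|) (λ { (_ ∷ ws) → ∉ ws })
  large : ∀ i → i < d → ∑Paths (M ℕ.+ d) n (f ∘ (D (M ℕ.+ i) ∷_)) ≡ + 0
  large i _ = ∑Paths-vanish (M ℕ.+ d) n (λ w |w| → f≡0 (D (M ℕ.+ i) ∷ w) (cong suc |w|)
    (λ { (down M+i<M ∷ _) → ℕₚ.<-irrefl refl (ℕₚ.<-≤-trans M+i<M (ℕₚ.m≤m+n M i)) }))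

∑Paths-alphabet-≤ : ∀ {M M′} n (f : Path → ℤ) → M ≤ M′ → (∀ w → length w ≡ n → ¬ All (InAlphabet M) w → f w ≡ + 0) →
  ∑Paths M′ n f ≡ ∑Paths M n f
∑Paths-alphabet-≤ {M} {M′} n f M≤M′ f≡0 =
  trans (cong (λ L → ∑Paths L n f) (sym (ℕₚ.m+[n∸m]≡n M≤M′))) (∑Paths-alphabet-+ M (M′ ∸ M) n f f≡0)

-- Geometry of paths

≡true⇒T : ∀ {b} → b ≡ true → T b
≡true⇒T = Equivalence.from Boolₚ.T-≡

∧-falseʳ : ∀ a {b} → b ≡ false → a ∧ b ≡ false
∧-falseʳ a refl = Boolₚ.∧-zeroʳ a

not-∨ : ∀ a b → not (a ∨ b) ≡ not a ∧ not b
not-∨ true  b = refl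
not-∨ false b = refl

nonnegFrom : ℕ → Path → Bool
nonnegFrom h []        = true
nonnegFrom h (U ∷ s)   = nonnegFrom (suc h) s
nonnegFrom h (D m ∷ s) = (suc m ≤ᵇ h) ∧ nonnegFrom (h ∸ suc m) s

nonnegFrom-D : ∀ h m w → nonnegFrom h (D m ∷ w) ≡ true →
  (suc m ≤ᵇ h) ≡ true × nonnegFrom (h ∸ suc m) w ≡ true
nonnegFrom-D h m w ok = Boolₚ.∧-conicalˡ (suc m ≤ᵇ h) _ ok , Boolₚ.∧-conicalʳ (suc m ≤ᵇ h) _ ok

endFrom : ℕ → Path → ℕ
endFrom h []      = h
endFrom h (s ∷ w) = endFrom (stepH h s) w

touchesFrom : ℕ → Path → Bool
touchesFrom h []      = false
touchesFrom h (s ∷ w) = (stepH h s ≡ᵇ 0) ∨ touchesFrom (stepH h s) w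

firstReturnsAtEnd : ℕ → Path → Bool
firstReturnsAtEnd h []          = false
firstReturnsAtEnd h (s ∷ [])    = stepH h s ≡ᵇ 0
firstReturnsAtEnd h (s ∷ t ∷ w) = not (stepH h s ≡ᵇ 0) ∧ firstReturnsAtEnd (stepH h s) (t ∷ w)

validFrom-++ : ∀ h w v → validFrom h (w ++ v) ≡ nonnegFrom h w ∧ validFrom (endFrom h w) v
validFrom-++ h []        v = refl
validFrom-++ h (U ∷ w)   v = validFrom-++ (suc h) w v
validFrom-++ h (D m ∷ w) v = trans (cong ((suc m ≤ᵇ h) ∧_) (validFrom-++ (h ∸ suc m) w v))
                                   (sym (Boolₚ.∧-assoc (suc m ≤ᵇ h) _ _))

validFrom-nonneg-end : ∀ h w → validFrom h w ≡ nonnegFrom h w ∧ (endFrom h w ≡ᵇ 0)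
validFrom-nonneg-end h w = trans (cong (validFrom h) (sym (Listₚ.++-identityʳ w))) (validFrom-++ h w [])

heightFrom-≥ : ∀ h w → h ≤ heightFrom h w
heightFrom-≥ h []      = ℕₚ.≤-refl
heightFrom-≥ h (s ∷ w) = ℕₚ.m≤m⊔n h _

endFrom≤heightFrom : ∀ h w → endFrom h w ≤ heightFrom h w
endFrom≤heightFrom h []      = ℕₚ.≤-refl
endFrom≤heightFrom h (s ∷ w) = ℕₚ.≤-trans (endFrom≤heightFrom (stepH h s) w) (ℕₚ.m≤n⊔m h _)

heightFrom-++ : ∀ h w v → heightFrom h (w ++ v) ≡ heightFrom h w ⊔ heightFrom (endFrom h w) v
heightFrom-++ h []      v = sym (ℕₚ.m≤n⇒m⊔n≡n (heightFrom-≥ h v))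
heightFrom-++ h (s ∷ w) v = trans (cong (h ⊔_) (heightFrom-++ (stepH h s) w v)) (sym (ℕₚ.⊔-assoc h _ _))

heightFrom-snoc-D : ∀ h w m → heightFrom h (w ++ D m ∷ []) ≡ heightFrom h w
heightFrom-snoc-D h w m = trans (heightFrom-++ h w (D m ∷ []))
  (ℕₚ.m≥n⇒m⊔n≡m (ℕₚ.⊔-lub (endFrom≤heightFrom h w)
                          (ℕₚ.≤-trans (ℕₚ.m∸n≤m (endFrom h w) (suc m)) (endFrom≤heightFrom h w))))

endFrom≤+length : ∀ h w → endFrom h w ≤ h ℕ.+ length w
endFrom≤+length h []        = ℕₚ.≤-reflexive (sym (ℕₚ.+-identityʳ h))
endFrom≤+length h (U ∷ w)   = subst (endFrom (suc h) w ≤_) (sym (ℕₚ.+-suc h (length w))) (endFrom≤+length (suc h) w)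
endFrom≤+length h (D m ∷ w) = ℕₚ.≤-trans (endFrom≤+length (h ∸ suc m) w)
  (ℕₚ.+-mono-≤ (ℕₚ.m∸n≤m h (suc m)) (ℕₚ.n≤1+n (length w)))

nonnegFrom⇒InAlphabet : ∀ h w M → h ℕ.+ length w ≤ M → nonnegFrom h w ≡ true → All (InAlphabet M) w
nonnegFrom⇒InAlphabet h []        M _ _ = []
nonnegFrom⇒InAlphabet h (U ∷ w)   M le ok =
  up ∷ nonnegFrom⇒InAlphabet (suc h) w M (subst (_≤ M) (ℕₚ.+-suc h (length w)) le) ok
nonnegFrom⇒InAlphabet h (D m ∷ w) M le ok with nonnegFrom-D h m w ok
... | m<h , ok′ =
  down (ℕₚ.<-≤-trans (ℕₚ.≤ᵇ⇒≤ (suc m) h (≡true⇒T m<h)) (ℕₚ.≤-trans (ℕₚ.m≤m+n h _) le))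
  ∷ nonnegFrom⇒InAlphabet (h ∸ suc m) w M
      (ℕₚ.≤-trans (ℕₚ.+-mono-≤ (ℕₚ.m∸n≤m h (suc m)) (ℕₚ.n≤1+n (length w))) le) ok′

firstReturnsAtEnd⇒endFrom≡0 : ∀ h w → firstReturnsAtEnd h w ≡ true → endFrom h w ≡ 0
firstReturnsAtEnd⇒endFrom≡0 h (s ∷ [])    e = ℕₚ.≡ᵇ⇒≡ (stepH h s) 0 (≡true⇒T e)
firstReturnsAtEnd⇒endFrom≡0 h (s ∷ t ∷ w) e =
  firstReturnsAtEnd⇒endFrom≡0 (stepH h s) (t ∷ w) (Boolₚ.∧-conicalʳ _ _ e)

firstReturnFrom-++ : ∀ h u v → firstReturnsAtEnd h u ≡ true → firstReturnFrom h (u ++ v) ≡ (u , v)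
firstReturnFrom-++ h (s ∷ []) v e with stepH h s ≡ᵇ 0
firstReturnFrom-++ h (s ∷ []) v refl | true = refl
firstReturnFrom-++ h (s ∷ t ∷ w) v e =
  trans (Boolₚ.if-cong {y = map₁ (s ∷_) (firstReturnFrom (stepH h s) (t ∷ w ++ v))} no-return-yet)
        (cong (map₁ (s ∷_)) (firstReturnFrom-++ (stepH h s) (t ∷ w) v (Boolₚ.∧-conicalʳ _ _ e)))
  where
  no-return-yet : (stepH h s ≡ᵇ 0) ≡ false
  no-return-yet = Equivalence.to Boolₚ.T-not-≡ (≡true⇒T (Boolₚ.∧-conicalˡ _ _ e))

≤ᵇ-suc : ∀ m h → (suc m ≤ᵇ h) ≡ true → (suc m ≤ᵇ suc h) ≡ true
≤ᵇ-suc m h m<h = Equivalence.to Boolₚ.T-≡ (ℕₚ.≤⇒≤ᵇ (ℕₚ.m≤n⇒m≤1+n (ℕₚ.≤ᵇ⇒≤ (suc m) h (≡true⇒T m<h))))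

∸-suc : ∀ m h → (suc m ≤ᵇ h) ≡ true → suc h ∸ suc m ≡ suc (h ∸ suc m)
∸-suc m h m<h = ℕₚ.+-∸-assoc 1 (ℕₚ.≤ᵇ⇒≤ (suc m) h (≡true⇒T m<h))

nonnegFrom-suc : ∀ h w → nonnegFrom h w ≡ true → nonnegFrom (suc h) w ≡ true
nonnegFrom-suc h []        ok = refl
nonnegFrom-suc h (U ∷ w)   ok = nonnegFrom-suc (suc h) w ok
nonnegFrom-suc h (D m ∷ w) ok with nonnegFrom-D h m w ok
... | m<h , ok′ = trans (cong₂ _∧_ (≤ᵇ-suc m h m<h) (cong (λ k → nonnegFrom k w) (∸-suc m h m<h)))
                        (nonnegFrom-suc (h ∸ suc m) w ok′)

endFrom-suc : ∀ h w → nonnegFrom h w ≡ true → endFrom (suc h) w ≡ suc (endFrom h w)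
endFrom-suc h []        ok = refl
endFrom-suc h (U ∷ w)   ok = endFrom-suc (suc h) w ok
endFrom-suc h (D m ∷ w) ok with nonnegFrom-D h m w ok
... | m<h , ok′ = trans (cong (λ k → endFrom k w) (∸-suc m h m<h)) (endFrom-suc (h ∸ suc m) w ok′)

heightFrom-suc : ∀ h w → nonnegFrom h w ≡ true → heightFrom (suc h) w ≡ suc (heightFrom h w)
heightFrom-suc h []        ok = refl
heightFrom-suc h (U ∷ w)   ok = cong (suc h ⊔_) (heightFrom-suc (suc h) w ok)
heightFrom-suc h (D m ∷ w) ok with nonnegFrom-D h m w ok
... | m<h , ok′ = cong (suc h ⊔_) (trans (cong (λ k → heightFrom k w) (∸-suc m h m<h))
                                         (heightFrom-suc (h ∸ suc m) w ok′))

touchesFrom-suc : ∀ h w → nonnegFrom h w ≡ true → touchesFrom (suc h) w ≡ false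
touchesFrom-suc h []        ok = refl
touchesFrom-suc h (U ∷ w)   ok = touchesFrom-suc (suc h) w ok
touchesFrom-suc h (D m ∷ w) ok with nonnegFrom-D h m w ok
... | m<h , ok′ = trans (cong (λ k → (k ≡ᵇ 0) ∨ touchesFrom k w) (∸-suc m h m<h))
                        (touchesFrom-suc (h ∸ suc m) w ok′)

firstReturnsAtEnd-snoc : ∀ h w s →
  firstReturnsAtEnd h (w ++ s ∷ []) ≡ not (touchesFrom h w) ∧ (stepH (endFrom h w) s ≡ᵇ 0)
firstReturnsAtEnd-snoc h []          s = refl
firstReturnsAtEnd-snoc h (t ∷ [])    s =
  cong (λ b → not b ∧ (stepH (stepH h t) s ≡ᵇ 0)) (sym (Boolₚ.∨-identityʳ (stepH h t ≡ᵇ 0)))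
firstReturnsAtEnd-snoc h (t ∷ u ∷ w) s = begin
  not z ∧ firstReturnsAtEnd (stepH h t) (u ∷ w ++ s ∷ [])
    ≡⟨ cong (not z ∧_) (firstReturnsAtEnd-snoc (stepH h t) (u ∷ w) s) ⟩
  not z ∧ (not (touchesFrom (stepH h t) (u ∷ w)) ∧ last-returns)
    ≡⟨ Boolₚ.∧-assoc (not z) _ _ ⟨
  (not z ∧ not (touchesFrom (stepH h t) (u ∷ w))) ∧ last-returns
    ≡⟨ cong (_∧ last-returns) (not-∨ z _) ⟨
  not (z ∨ touchesFrom (stepH h t) (u ∷ w)) ∧ last-returns ∎
  where
  open ≡-Reasoning
  z = stepH h t ≡ᵇ 0
  last-returns = stepH (endFrom h (t ∷ u ∷ w)) s ≡ᵇ 0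

∑-firstReturn-prefixes : ∀ h γ →
  ∑ (length γ) (λ i → χ (firstReturnsAtEnd h (take (suc i) γ))) ≡ χ (touchesFrom h γ)
∑-firstReturn-prefixes h []          = refl
∑-firstReturn-prefixes h (s ∷ [])    with stepH h s ≡ᵇ 0
... | true  = refl
... | false = refl
∑-firstReturn-prefixes h (s ∷ t ∷ γ) =
  first-or-later (stepH h s ≡ᵇ 0) (λ i → firstReturnsAtEnd (stepH h s) (take (suc i) (t ∷ γ)))
                 (touchesFrom (stepH h s) (t ∷ γ)) (∑-firstReturn-prefixes (stepH h s) (t ∷ γ))
  where
  n : ℕ
  n = suc (length γ)
  first-or-later : ∀ z (F : ℕ → Bool) X → ∑ n (λ i → χ (F i)) ≡ χ X → χ z + ∑ n (λ i → χ (not z ∧ F i)) ≡ χ (z ∨ X)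
  first-or-later true  F X _ = cong (_+_ (+ 1)) (∑-zero n)
  first-or-later false F X e = trans (ℤₚ.+-identityˡ (∑ n (λ i → χ (F i)))) e

untouched-invalid : ∀ h p → (h ≡ᵇ 0) ≡ false → touchesFrom h p ≡ false → validFrom h p ≡ false
untouched-invalid h []        h≢0 _ = h≢0
untouched-invalid h (U ∷ p)   h≢0 t = untouched-invalid (suc h) p refl t
untouched-invalid h (D m ∷ p) h≢0 t = ∧-falseʳ (suc m ≤ᵇ h)
  (untouched-invalid (h ∸ suc m) p (Boolₚ.∨-conicalˡ _ _ t) (Boolₚ.∨-conicalʳ _ _ t))

valid⇒touches : ∀ s p → validFrom 0 (s ∷ p) ≡ true → touchesFrom 0 (s ∷ p) ≡ true
valid⇒touches U p valid with touchesFrom 1 p in t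
... | true  = refl
... | false with trans (sym valid) (untouched-invalid 1 p refl t)
... | ()

validFrom-snoc-U : ∀ h w → validFrom h (w ++ U ∷ []) ≡ false
validFrom-snoc-U h w = trans (validFrom-++ h w (U ∷ [])) (∧-falseʳ (nonnegFrom h w) refl)

validFrom-[D] : ∀ m → validFrom (suc m) (D m ∷ []) ≡ true
validFrom-[D] zero    = refl
validFrom-[D] (suc m) = validFrom-[D] m

validFrom-[D]⇒ : ∀ e m → validFrom e (D m ∷ []) ≡ true → e ≡ suc m
validFrom-[D]⇒ e m valid = ℕₚ.≤-antisym
  (ℕₚ.m∸n≡0⇒m≤n (ℕₚ.≡ᵇ⇒≡ (e ∸ suc m) 0 (≡true⇒T (Boolₚ.∧-conicalʳ (suc m ≤ᵇ e) _ valid))))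
  (ℕₚ.≤ᵇ⇒≤ (suc m) e (≡true⇒T (Boolₚ.∧-conicalˡ (suc m ≤ᵇ e) _ valid)))

validFrom-snoc-D : ∀ w m → validFrom 0 (w ++ D m ∷ []) ≡ true → nonnegFrom 0 w ≡ true × endFrom 0 w ≡ suc m
validFrom-snoc-D w m valid =
  Boolₚ.∧-conicalˡ (nonnegFrom 0 w) _ valid′ , validFrom-[D]⇒ (endFrom 0 w) m (Boolₚ.∧-conicalʳ (nonnegFrom 0 w) _ valid′)
  where
  valid′ : nonnegFrom 0 w ∧ validFrom (endFrom 0 w) (D m ∷ []) ≡ true
  valid′ = trans (sym (validFrom-++ 0 w (D m ∷ []))) valid

noDD-++-U : ∀ u v → noDD (u ++ U ∷ v) ≡ noDD u ∧ noDD (U ∷ v)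
noDD-++-U []              v = refl
noDD-++-U (U ∷ u)         v = noDD-++-U u v
noDD-++-U (D m ∷ [])      v = refl
noDD-++-U (D m ∷ U ∷ u)   v = noDD-++-U (U ∷ u) v
noDD-++-U (D m ∷ D n ∷ u) v = refl

noDD-snoc-D : ∀ w a b → noDD (w ++ D a ∷ []) ≡ noDD (w ++ D b ∷ [])
noDD-snoc-D []              a b = refl
noDD-snoc-D (U ∷ w)         a b = noDD-snoc-D w a b
noDD-snoc-D (D m ∷ [])      a b = refl
noDD-snoc-D (D m ∷ U ∷ w)   a b = noDD-snoc-D (U ∷ w) a b
noDD-snoc-D (D m ∷ D n ∷ w) a b = refl

lowerLast-snoc : ∀ w s → lowerLast (w ++ s ∷ []) ≡ w ++ lowerStep s ∷ []
lowerLast-snoc []          s = refl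
lowerLast-snoc (t ∷ [])    s = refl
lowerLast-snoc (t ∷ u ∷ w) s = cong (t ∷_) (lowerLast-snoc (u ∷ w) s)

length-lowerLast : ∀ w → length (lowerLast w) ≡ length w
length-lowerLast []          = refl
length-lowerLast (s ∷ [])    = refl
length-lowerLast (s ∷ t ∷ w) = cong suc (length-lowerLast (t ∷ w))

-- Membership in ℋ

firstReturnFrom-head : ∀ h s p → Σ Path λ a → proj₁ (firstReturnFrom h (s ∷ p)) ≡ s ∷ a
firstReturnFrom-head h s p with stepH h s ≡ᵇ 0
... | true  = [] , refl
... | false = proj₁ (firstReturnFrom (stepH h s) p) , refl

firstReturnFrom-length : ∀ h γ →
  length (proj₁ (firstReturnFrom h γ)) ℕ.+ length (proj₂ (firstReturnFrom h γ)) ≡ length γ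
firstReturnFrom-length h []      = refl
firstReturnFrom-length h (s ∷ p) with stepH h s ≡ᵇ 0
... | true  = refl
... | false = cong suc (firstReturnFrom-length (stepH h s) p)

length-lowering-firstReturn : ∀ h s p → length (lowering (proj₁ (firstReturnFrom h (s ∷ p)))) ≤ length p
length-lowering-firstReturn h s p with firstReturnFrom-head h s p | firstReturnFrom-length h (s ∷ p)
... | a , α≡s∷a | |α|+|β| rewrite α≡s∷a | length-lowerLast a =
  ℕₚ.m+n≤o⇒m≤o (length a) (ℕₚ.≤-reflexive (ℕₚ.suc-injective |α|+|β|))

length-rest-firstReturn : ∀ h s p → length (proj₂ (firstReturnFrom h (s ∷ p))) ≤ length p
length-rest-firstReturn h s p with firstReturnFrom-head h s p | firstReturnFrom-length h (s ∷ p)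
... | a , α≡s∷a | |α|+|β| rewrite α≡s∷a =
  ℕₚ.m+n≤o⇒n≤o (length a) (ℕₚ.≤-reflexive (ℕₚ.suc-injective |α|+|β|))

inHFuel-sufficient : ∀ f g γ → length γ ≤ f → length γ ≤ g → inHFuel f γ ≡ inHFuel g γ
inHFuel-sufficient f       g       []      _         _         = refl
inHFuel-sufficient (suc f) (suc g) (s ∷ p) (s≤s |p|≤f) (s≤s |p|≤g) =
  cong₂ (λ lowered rest → isDAP (s ∷ p) ∧ (isUD α ∨ lowered) ∧ rest ∧ (height β ≤ᵇ height α))
    (inHFuel-sufficient f g (lowering α) (ℕₚ.≤-trans |α♭| |p|≤f) (ℕₚ.≤-trans |α♭| |p|≤g))
    (inHFuel-sufficient f g β (ℕₚ.≤-trans |β| |p|≤f) (ℕₚ.≤-trans |β| |p|≤g))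
  where
  α = proj₁ (firstReturn (s ∷ p))
  β = proj₂ (firstReturn (s ∷ p))
  |α♭| = length-lowering-firstReturn 0 s p
  |β|  = length-rest-firstReturn 0 s p

inH-unfold : ∀ s p → let α = proj₁ (firstReturn (s ∷ p)); β = proj₂ (firstReturn (s ∷ p)) in
  inH (s ∷ p) ≡ isDAP (s ∷ p) ∧ (isUD α ∨ inH (lowering α)) ∧ inH β ∧ (height β ≤ᵇ height α)
inH-unfold s p =
  cong₂ (λ lowered rest → isDAP (s ∷ p) ∧ (isUD α ∨ lowered) ∧ rest ∧ (height β ≤ᵇ height α))
    (inHFuel-sufficient (length p) (length (lowering α)) (lowering α) (length-lowering-firstReturn 0 s p) ℕₚ.≤-refl)
    (inHFuel-sufficient (length p) (length β) β (length-rest-firstReturn 0 s p) ℕₚ.≤-refl)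
  where
  α = proj₁ (firstReturn (s ∷ p))
  β = proj₂ (firstReturn (s ∷ p))

inH⇒isDAP : ∀ s p → inH (s ∷ p) ≡ true → isDAP (s ∷ p) ≡ true
inH⇒isDAP s p γ∈H = Boolₚ.∧-conicalˡ (isDAP (s ∷ p)) _ (trans (sym (inH-unfold s p)) γ∈H)

inH⇒valid : ∀ γ → inH γ ≡ true → validFrom 0 γ ≡ true
inH⇒valid []      _   = refl
inH⇒valid (s ∷ p) γ∈H = Boolₚ.∧-conicalˡ (validFrom 0 (s ∷ p)) _ (inH⇒isDAP s p γ∈H)

inH⇒noDD : ∀ γ → inH γ ≡ true → noDD γ ≡ true
inH⇒noDD []      _   = refl
inH⇒noDD (s ∷ p) γ∈H = Boolₚ.∧-conicalʳ (validFrom 0 (s ∷ p)) _ (inH⇒isDAP s p γ∈H)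

inH⇒InAlphabet : ∀ γ → inH γ ≡ true → All (InAlphabet (length γ)) γ
inH⇒InAlphabet γ γ∈H = nonnegFrom⇒InAlphabet 0 γ (length γ) ℕₚ.≤-refl
  (Boolₚ.∧-conicalˡ (nonnegFrom 0 γ) _ (trans (sym (validFrom-nonneg-end 0 γ)) (inH⇒valid γ γ∈H)))

inH⇒starts-U : ∀ s p → inH (s ∷ p) ≡ true → s ≡ U
inH⇒starts-U U     p _   = refl
inH⇒starts-U (D m) p γ∈H with () ← inH⇒valid (D m ∷ p) γ∈H

inH⇒height≥1 : ∀ s p → inH (s ∷ p) ≡ true → 1 ≤ height (s ∷ p)
inH⇒height≥1 s p γ∈H rewrite inH⇒starts-U s p γ∈H = heightFrom-≥ 1 p

-- The first return decomposition

H≤ : ℕ → Path → ℤ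
H≤ k γ = χ (inH γ ∧ (height γ ≤ᵇ k))

H≡ : ℕ → Path → ℤ
H≡ k γ = χ (inH γ ∧ (height γ ≡ᵇ k))

Block : ℕ → Path → ℤ
Block k u = χ (isDAP u ∧ (isUD u ∨ inH (lowering u)) ∧ (height u ≡ᵇ k))

max≡-split : ∀ a b k → χ ((b ≤ᵇ a) ∧ ((a ⊔ b) ≡ᵇ k)) ≡ χ (a ≡ᵇ k) * χ (b ≤ᵇ k)
max≡-split a b k with a ≡ᵇ k in a≡k
... | false with b ≤ᵇ a in b≤a
...   | false = refl
...   | true rewrite ℕₚ.m≥n⇒m⊔n≡m (ℕₚ.≤ᵇ⇒≤ b a (≡true⇒T b≤a)) | a≡k = refl
max≡-split a b k | true with refl ← ℕₚ.≡ᵇ⇒≡ a k (≡true⇒T a≡k) with b ≤ᵇ a in b≤a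
...   | false = refl
...   | true rewrite ℕₚ.m≥n⇒m⊔n≡m (ℕₚ.≤ᵇ⇒≤ b a (≡true⇒T b≤a)) | a≡k = refl

indicator-factorises : ∀ dap-uv dap-u lowered v∈H a b k → (v∈H ≡ true → dap-uv ≡ dap-u) →
  χ ((dap-uv ∧ lowered ∧ v∈H ∧ (b ≤ᵇ a)) ∧ ((a ⊔ b) ≡ᵇ k))
    ≡ χ (dap-u ∧ lowered ∧ (a ≡ᵇ k)) * χ (v∈H ∧ (b ≤ᵇ k))
indicator-factorises dap-uv dap-u lowered false a b k _ =
  trans (cong χ excluded) (sym (*-χ-false (χ (dap-u ∧ lowered ∧ (a ≡ᵇ k))) refl))
  where
  excluded : (dap-uv ∧ lowered ∧ false ∧ (b ≤ᵇ a)) ∧ ((a ⊔ b) ≡ᵇ k) ≡ false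
  excluded rewrite Boolₚ.∧-zeroʳ lowered | Boolₚ.∧-zeroʳ dap-uv = refl
indicator-factorises dap-uv dap-u lowered true a b k same rewrite same refl with dap-u | lowered
... | true  | true  = max≡-split a b k
... | true  | false = refl
... | false | _     = refl

noDD-++-inH : ∀ u v → inH v ≡ true → noDD (u ++ v) ≡ noDD u
noDD-++-inH u []      _   = cong noDD (Listₚ.++-identityʳ u)
noDD-++-inH u (t ∷ v) v∈H with refl ← inH⇒starts-U t v v∈H =
  trans (noDD-++-U u v) (trans (cong (noDD u ∧_) (inH⇒noDD (U ∷ v) v∈H)) (Boolₚ.∧-identityʳ (noDD u)))

isDAP-++ : ∀ s u v → firstReturnsAtEnd 0 (s ∷ u) ≡ true → inH v ≡ true → isDAP (s ∷ u ++ v) ≡ isDAP (s ∷ u)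
isDAP-++ s u v returns v∈H = cong₂ _∧_ valid (noDD-++-inH (s ∷ u) v v∈H)
  where
  end≡0 = firstReturnsAtEnd⇒endFrom≡0 0 (s ∷ u) returns
  valid : validFrom 0 (s ∷ u ++ v) ≡ validFrom 0 (s ∷ u)
  valid = begin
    validFrom 0 (s ∷ u ++ v)                                  ≡⟨ validFrom-++ 0 (s ∷ u) v ⟩
    nonnegFrom 0 (s ∷ u) ∧ validFrom (endFrom 0 (s ∷ u)) v    ≡⟨ cong (λ h → nonnegFrom 0 (s ∷ u) ∧ validFrom h v) end≡0 ⟩
    nonnegFrom 0 (s ∷ u) ∧ validFrom 0 v                      ≡⟨ cong (nonnegFrom 0 (s ∷ u) ∧_) (inH⇒valid v v∈H) ⟩
    nonnegFrom 0 (s ∷ u) ∧ true                               ≡⟨ cong (λ h → nonnegFrom 0 (s ∷ u) ∧ (h ≡ᵇ 0)) end≡0 ⟨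
    nonnegFrom 0 (s ∷ u) ∧ (endFrom 0 (s ∷ u) ≡ᵇ 0)           ≡⟨ validFrom-nonneg-end 0 (s ∷ u) ⟨
    validFrom 0 (s ∷ u)                                       ∎
    where open ≡-Reasoning

inH-firstReturn-++ : ∀ u v → firstReturnsAtEnd 0 u ≡ true →
  inH (u ++ v) ≡ isDAP (u ++ v) ∧ (isUD u ∨ inH (lowering u)) ∧ inH v ∧ (height v ≤ᵇ height u)
inH-firstReturn-++ (s ∷ u) v returns = trans (inH-unfold s (u ++ v))
  (cong (λ (r : Path × Path) → isDAP (s ∷ u ++ v) ∧ (isUD (proj₁ r) ∨ inH (lowering (proj₁ r))) ∧ inH (proj₂ r)
                                 ∧ (height (proj₂ r) ≤ᵇ height (proj₁ r)))
        (firstReturnFrom-++ 0 (s ∷ u) v returns))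

height-firstReturn-++ : ∀ u v → firstReturnsAtEnd 0 u ≡ true → height (u ++ v) ≡ height u ⊔ height v
height-firstReturn-++ u v returns = trans (heightFrom-++ 0 u v)
  (cong (λ h → height u ⊔ heightFrom h v) (firstReturnsAtEnd⇒endFrom≡0 0 u returns))

H≡-firstReturn-++ : ∀ k u v → firstReturnsAtEnd 0 u ≡ true → H≡ k (u ++ v) ≡ Block k u * H≤ k v
H≡-firstReturn-++ k (s ∷ u) v returns =
  trans (cong₂ (λ b h → χ (b ∧ (h ≡ᵇ k))) (inH-firstReturn-++ (s ∷ u) v returns) (height-firstReturn-++ (s ∷ u) v returns))
        (indicator-factorises (isDAP (s ∷ u ++ v)) (isDAP (s ∷ u)) (isUD (s ∷ u) ∨ inH (lowering (s ∷ u))) (inH v)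
                              (height (s ∷ u)) (height v) k (isDAP-++ s u v returns))

FirstBlock : ℕ → Path → ℤ
FirstBlock k u = χ (firstReturnsAtEnd 0 u) * Block k u

inH-snoc-U : ∀ w → inH (w ++ U ∷ []) ≡ false
inH-snoc-U w with inH (w ++ U ∷ []) in w∈H
... | false = refl
... | true with () ← trans (sym (inH⇒valid (w ++ U ∷ []) w∈H)) (validFrom-snoc-U 0 w)

inH-snoc-too-deep : ∀ w m → length w ≤ m → inH (w ++ D m ∷ []) ≡ false
inH-snoc-too-deep w m |w|≤m with inH (w ++ D m ∷ []) in w∈H
... | false = refl
... | true = ⊥-elim (ℕₚ.<-irrefl refl (ℕₚ.≤-trans end≤ |w|≤m))
  where
  end≤ : suc m ≤ length w
  end≤ = subst (_≤ length w) (proj₂ (validFrom-snoc-D w m (inH⇒valid (w ++ D m ∷ []) w∈H))) (endFrom≤+length 0 w)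

isUD-long : ∀ t w s → isUD (U ∷ t ∷ w ++ s ∷ []) ≡ false
isUD-long U           w       s = refl
isUD-long (D (suc m)) w       s = refl
isUD-long (D zero)    []      s = refl
isUD-long (D zero)    (_ ∷ w) s = refl

isUD-lifted : ∀ w m → isUD (U ∷ w ++ D (suc m) ∷ []) ≡ false
isUD-lifted []      m = refl
isUD-lifted (t ∷ w) m = isUD-long t w (D (suc m))

-- Raising a path of ℋ ending in D_k by one level (prepend U, end with D_{k+1}) gives the
-- prime DAP whose lowering it is.
FirstBlock-lift : ∀ j w m → FirstBlock (suc j) (U ∷ w ++ D (suc m) ∷ []) ≡ H≡ j (w ++ D m ∷ [])
FirstBlock-lift j w m rewrite isUD-lifted w m | lowerLast-snoc w (D (suc m)) with inH (w ++ D m ∷ []) in δ∈H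
... | false = *-χ-false (χ (firstReturnsAtEnd 0 (U ∷ w ++ D (suc m) ∷ []))) (∧-falseʳ (isDAP (U ∷ w ++ D (suc m) ∷ [])) refl)
... | true = lifted
  where
  nonneg&end = validFrom-snoc-D w m (inH⇒valid (w ++ D m ∷ []) δ∈H)
  nonneg = proj₁ nonneg&end
  end-lifted : endFrom 1 w ≡ suc (suc m)
  end-lifted = trans (endFrom-suc 0 w nonneg) (cong suc (proj₂ nonneg&end))
  returns : firstReturnsAtEnd 0 (U ∷ w ++ D (suc m) ∷ []) ≡ true
  returns = trans (firstReturnsAtEnd-snoc 0 (U ∷ w) (D (suc m)))
                  (cong₂ (λ t e → not t ∧ (stepH e (D (suc m)) ≡ᵇ 0)) (touchesFrom-suc 0 w nonneg) end-lifted
                   ⟨ trans ⟩ cong (_≡ᵇ 0) (ℕₚ.n∸n≡0 m))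
  valid : validFrom 0 (U ∷ w ++ D (suc m) ∷ []) ≡ true
  valid = trans (validFrom-++ 1 w (D (suc m) ∷ []))
                (cong₂ (λ a e → a ∧ validFrom e (D (suc m) ∷ [])) (nonnegFrom-suc 0 w nonneg) end-lifted
                 ⟨ trans ⟩ validFrom-[D] (suc m))
  no-DD : noDD (U ∷ w ++ D (suc m) ∷ []) ≡ true
  no-DD = trans (noDD-snoc-D w (suc m) m) (inH⇒noDD (w ++ D m ∷ []) δ∈H)
  height-lifted : height (U ∷ w ++ D (suc m) ∷ []) ≡ suc (height (w ++ D m ∷ []))
  height-lifted = trans (heightFrom-snoc-D 1 w (suc m))
                        (trans (heightFrom-suc 0 w nonneg) (cong suc (sym (heightFrom-snoc-D 0 w m))))
  lifted : χ (firstReturnsAtEnd 0 (U ∷ w ++ D (suc m) ∷ [])) * χ (isDAP (U ∷ w ++ D (suc m) ∷ []) ∧ true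
             ∧ (height (U ∷ w ++ D (suc m) ∷ []) ≡ᵇ suc j))
           ≡ χ (height (w ++ D m ∷ []) ≡ᵇ j)
  lifted rewrite returns | valid | no-DD | height-lifted = ℤₚ.*-identityˡ _

FirstBlock-UD : ∀ j → FirstBlock (suc j) (U ∷ D 0 ∷ []) ≡ χ (0 ≡ᵇ j)
FirstBlock-UD zero    = refl
FirstBlock-UD (suc j) = refl

-- A longer block ending in U D would lower to a path ending below the axis.
FirstBlock-long-UD : ∀ k t w → FirstBlock k (U ∷ t ∷ w ++ D 0 ∷ []) ≡ + 0
FirstBlock-long-UD k t w rewrite isUD-long t w (D 0) | lowerLast-snoc (t ∷ w) (D 0)
  with inH (t ∷ w ++ D 0 ∷ []) in δ∈H
... | false = *-χ-false (χ (firstReturnsAtEnd 0 (U ∷ t ∷ w ++ D 0 ∷ []))) (∧-falseʳ (isDAP (U ∷ t ∷ w ++ D 0 ∷ [])) refl)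
... | true = χ-false-* _ no-return
  where
  nonneg&end = validFrom-snoc-D (t ∷ w) 0 (inH⇒valid (t ∷ w ++ D 0 ∷ []) δ∈H)
  no-return : firstReturnsAtEnd 0 (U ∷ t ∷ w ++ D 0 ∷ []) ≡ false
  no-return = trans (firstReturnsAtEnd-snoc 0 (U ∷ t ∷ w) (D 0))
    (∧-falseʳ (not (touchesFrom 0 (U ∷ t ∷ w)))
              (cong (λ e → stepH e (D 0) ≡ᵇ 0) (trans (endFrom-suc 0 (t ∷ w) (proj₁ nonneg&end))
                                                       (cong suc (proj₂ nonneg&end)))))

FirstBlock-D : ∀ k m w → FirstBlock k (D m ∷ w) ≡ + 0
FirstBlock-D k m w = ℤₚ.*-zeroʳ (χ (firstReturnsAtEnd 0 (D m ∷ w)))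

FirstBlock-snoc-U : ∀ k w → FirstBlock k (U ∷ w ++ U ∷ []) ≡ + 0
FirstBlock-snoc-U k w rewrite validFrom-snoc-U 0 (U ∷ w) = ℤₚ.*-zeroʳ (χ (firstReturnsAtEnd 0 (U ∷ w ++ U ∷ [])))

-- Generating functions

Bexact : ℕ → Series
Bexact k n = ∑Paths n n (H≡ k)

∑Paths-inH-alphabet : ∀ (c : Path → Bool) {M} n → n ≤ M →
  ∑Paths M n (λ w → χ (inH w ∧ c w)) ≡ ∑Paths n n (λ w → χ (inH w ∧ c w))
∑Paths-inH-alphabet c n n≤M = ∑Paths-alphabet-≤ n _ n≤M outside
  where
  outside : ∀ w → length w ≡ n → ¬ All (InAlphabet n) w → χ (inH w ∧ c w) ≡ + 0
  outside w refl ∉ with inH w in w∈H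
  ... | false = refl
  ... | true  = ⊥-elim (∉ (inH⇒InAlphabet w w∈H))

B-∑Paths : ∀ k {M} n → n ≤ M → B k n ≡ ∑Paths M n (H≤ k)
B-∑Paths k n n≤M = trans (count-words n n _) (sym (∑Paths-inH-alphabet (λ w → height w ≤ᵇ k) n n≤M))

Bexact-∑Paths : ∀ k {M} n → n ≤ M → Bexact k n ≡ ∑Paths M n (H≡ k)
Bexact-∑Paths k n n≤M = sym (∑Paths-inH-alphabet (λ w → height w ≡ᵇ k) n n≤M)

≤ᵇ-suc-suc : ∀ h j → (suc h ≤ᵇ suc j) ≡ (h ≤ᵇ j)
≤ᵇ-suc-suc zero    j = refl
≤ᵇ-suc-suc (suc h) j = refl

χ-≤ᵇ-suc : ∀ h j → χ (h ≤ᵇ suc j) ≡ χ (h ≤ᵇ j) + χ (h ≡ᵇ suc j)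
χ-≤ᵇ-suc zero          j       = refl
χ-≤ᵇ-suc (suc zero)    zero    = refl
χ-≤ᵇ-suc (suc (suc h)) zero    = refl
χ-≤ᵇ-suc (suc h)       (suc j) rewrite ≤ᵇ-suc-suc h (suc j) | ≤ᵇ-suc-suc h j = χ-≤ᵇ-suc h j

H≤-suc : ∀ j w → H≤ (suc j) w ≡ H≤ j w + H≡ (suc j) w
H≤-suc j w with inH w
... | false = refl
... | true  = χ-≤ᵇ-suc (height w) j

B-suc : ∀ j n → B (suc j) n ≡ B j n + Bexact (suc j) n
B-suc j n = begin
  B (suc j) n                                ≡⟨ B-∑Paths (suc j) n ℕₚ.≤-refl ⟩
  ∑Paths n n (H≤ (suc j))                    ≡⟨ ∑Paths-cong n n (λ w _ → H≤-suc j w) ⟩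
  ∑Paths n n (λ w → H≤ j w + H≡ (suc j) w)   ≡⟨ ∑Paths-distrib-+ n n (H≤ j) (H≡ (suc j)) ⟩
  ∑Paths n n (H≤ j) + Bexact (suc j) n       ≡⟨ cong (_+ Bexact (suc j) n) (B-∑Paths j n ℕₚ.≤-refl) ⟨
  B j n + Bexact (suc j) n                   ∎
  where open ≡-Reasoning

χ-inH-positive-height : ∀ (c : ℕ → Bool) → (∀ h → c (suc h) ≡ false) →
  ∀ s p → χ (inH (s ∷ p) ∧ c (height (s ∷ p))) ≡ + 0
χ-inH-positive-height c c-suc s p with inH (s ∷ p) in γ∈H
... | false = refl
... | true with height (s ∷ p) | inH⇒height≥1 s p γ∈H
...   | suc h | _ rewrite c-suc h = refl

B-zero : B 0 ≗ one
B-zero zero    = refl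
B-zero (suc n) = trans (B-∑Paths 0 (suc n) ℕₚ.≤-refl)
  (∑Paths-vanish (suc n) (suc n) {H≤ 0} λ { (s ∷ p) _ → χ-inH-positive-height (_≤ᵇ 0) (λ _ → refl) s p })

Bexact-zero : ∀ n → Bexact 0 (suc n) ≡ + 0
Bexact-zero n =
  ∑Paths-vanish (suc n) (suc n) {H≡ 0} λ { (s ∷ p) _ → χ-inH-positive-height (_≡ᵇ 0) (λ _ → refl) s p }

take-length-++ : ∀ (u v : Path) → take (length u) (u ++ v) ≡ u
take-length-++ []      v = refl
take-length-++ (s ∷ u) v = cong (s ∷_) (take-length-++ u v)

H≡-firstReturn-factor : ∀ k u v → χ (firstReturnsAtEnd 0 u) * H≡ k (u ++ v) ≡ FirstBlock k u * H≤ k v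
H≡-firstReturn-factor k u v with firstReturnsAtEnd 0 u in returns
... | false = refl
... | true  = trans (ℤₚ.*-identityˡ (H≡ k (u ++ v)))
                    (trans (H≡-firstReturn-++ k u v returns) (cong (_* H≤ k v) (sym (ℤₚ.*-identityˡ (Block k u)))))

∑Paths-firstReturn-at : ∀ k n i → i < n →
  ∑Paths n n (λ γ → χ (firstReturnsAtEnd 0 (take (suc i) γ)) * H≡ k γ) ≡ ∑Paths n (suc i) (FirstBlock k) * B k (n ∸ suc i)
∑Paths-firstReturn-at k n i i<n = begin
  ∑Paths n n f
    ≡⟨ cong (λ l → ∑Paths n l f) (ℕₚ.m+[n∸m]≡n i<n) ⟨
  ∑Paths n (suc i ℕ.+ r) f
    ≡⟨ ∑Paths-++ n (suc i) r f ⟩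
  ∑Paths n (suc i) (λ u → ∑Paths n r (λ v → f (u ++ v)))
    ≡⟨ ∑Paths-cong n (suc i) split ⟩
  ∑Paths n (suc i) (λ u → FirstBlock k u * ∑Paths n r (H≤ k))
    ≡⟨ ∑Paths-*ʳ n (suc i) (∑Paths n r (H≤ k)) (FirstBlock k) ⟩
  ∑Paths n (suc i) (FirstBlock k) * ∑Paths n r (H≤ k)
    ≡⟨ cong (∑Paths n (suc i) (FirstBlock k) *_) (B-∑Paths k r (ℕₚ.m∸n≤m n (suc i))) ⟨
  ∑Paths n (suc i) (FirstBlock k) * B k r ∎
  where
  open ≡-Reasoning
  r = n ∸ suc i
  f : Path → ℤ
  f γ = χ (firstReturnsAtEnd 0 (take (suc i) γ)) * H≡ k γ
  split : ∀ u → length u ≡ suc i → ∑Paths n r (λ v → f (u ++ v)) ≡ FirstBlock k u * ∑Paths n r (H≤ k)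
  split u |u| = trans (∑Paths-cong n r λ v _ → trans (cong (λ p → χ (firstReturnsAtEnd 0 p) * H≡ k (u ++ v)) (prefix v))
                                                      (H≡-firstReturn-factor k u v))
                      (∑Paths-*ˡ n r (FirstBlock k u) (H≤ k))
    where
    prefix : ∀ v → take (suc i) (u ++ v) ≡ u
    prefix v = trans (cong (λ l → take l (u ++ v)) (sym |u|)) (take-length-++ u v)

H≡-touches : ∀ j γ → H≡ (suc j) γ ≡ χ (touchesFrom 0 γ) * H≡ (suc j) γ
H≡-touches j []      = refl
H≡-touches j (s ∷ p) with inH (s ∷ p) in γ∈H
... | false = sym (ℤₚ.*-zeroʳ (χ (touchesFrom 0 (s ∷ p))))
... | true rewrite valid⇒touches s p (inH⇒valid (s ∷ p) γ∈H) = sym (ℤₚ.*-identityˡ _)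

Bexact-firstReturn : ∀ j n → Bexact (suc j) n ≡ ∑ n (λ i → ∑Paths n (suc i) (FirstBlock (suc j)) * B (suc j) (n ∸ suc i))
Bexact-firstReturn j n = begin
  ∑Paths n n (H≡ k)                                                ≡⟨ ∑Paths-cong n n prefixes ⟩
  ∑Paths n n (λ γ → ∑ n (λ i → returns-at i γ * H≡ k γ))           ≡⟨ ∑Paths-∑ n n n (λ i γ → returns-at i γ * H≡ k γ) ⟩
  ∑ n (λ i → ∑Paths n n (λ γ → returns-at i γ * H≡ k γ))           ≡⟨ ∑-cong n (∑Paths-firstReturn-at k n) ⟩
  ∑ n (λ i → ∑Paths n (suc i) (FirstBlock k) * B k (n ∸ suc i))    ∎
  where
  open ≡-Reasoning
  k = suc j
  returns-at : ℕ → Path → ℤ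
  returns-at i γ = χ (firstReturnsAtEnd 0 (take (suc i) γ))
  prefixes : ∀ γ → length γ ≡ n → H≡ k γ ≡ ∑ n (λ i → returns-at i γ * H≡ k γ)
  prefixes γ refl = begin
    H≡ k γ                                                 ≡⟨ H≡-touches j γ ⟩
    χ (touchesFrom 0 γ) * H≡ k γ                           ≡⟨ cong (_* H≡ k γ) (∑-firstReturn-prefixes 0 γ) ⟨
    ∑ (length γ) (λ i → returns-at i γ) * H≡ k γ           ≡⟨ ∑-*ʳ (length γ) (H≡ k γ) (λ i → returns-at i γ) ⟨
    ∑ (length γ) (λ i → returns-at i γ * H≡ k γ)           ∎

Bprev : ℕ → Series
Bprev zero    = one ⊖ X
Bprev (suc j) = B j

∑Paths-FirstBlock-U : ∀ k n i → ∑Paths n (suc i) (FirstBlock k) ≡ ∑Paths n i (FirstBlock k ∘ (U ∷_))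
∑Paths-FirstBlock-U k n i =
  trans (cong (_+_ (∑Paths n i (FirstBlock k ∘ (U ∷_))))
              (∑-vanish n (λ m _ → ∑Paths-vanish n i (λ w _ → FirstBlock-D k m w))))
        (ℤₚ.+-identityʳ _)

∑Paths-UD-blocks : ∀ j n i → ∑Paths n i (λ w → FirstBlock (suc j) (U ∷ w ++ D 0 ∷ [])) ≡ χ ((i ≡ᵇ 0) ∧ (0 ≡ᵇ j))
∑Paths-UD-blocks j n zero    = FirstBlock-UD j
∑Paths-UD-blocks j n (suc i) = ∑Paths-vanish n (suc i) {λ w → FirstBlock (suc j) (U ∷ w ++ D 0 ∷ [])}
  λ { (t ∷ w) _ → FirstBlock-long-UD (suc j) t w }

∑Paths-lifted-blocks : ∀ j n i → i < n →
  ∑Paths (suc n) i (λ w → ∑ n (λ m → H≡ j (w ++ D m ∷ []))) ≡ Bexact j (suc i)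
∑Paths-lifted-blocks j n i i<n = begin
  ∑Paths (suc n) i (λ w → ∑ n (λ m → H≡ j (w ++ D m ∷ [])))      ≡⟨ ∑Paths-cong (suc n) i last-step ⟩
  ∑Paths (suc n) i (λ w → ∑Paths (suc n) 1 (λ v → H≡ j (w ++ v))) ≡⟨ ∑Paths-++ (suc n) i 1 (H≡ j) ⟨
  ∑Paths (suc n) (i ℕ.+ 1) (H≡ j)                                 ≡⟨ cong (λ l → ∑Paths (suc n) l (H≡ j)) (ℕₚ.+-comm i 1) ⟩
  ∑Paths (suc n) (suc i) (H≡ j)                                   ≡⟨ Bexact-∑Paths j (suc i) (s≤s (ℕₚ.<⇒≤ i<n)) ⟨
  Bexact j (suc i)                                                ∎
  where
  open ≡-Reasoning
  last-step : ∀ w → length w ≡ i → ∑ n (λ m → H≡ j (w ++ D m ∷ [])) ≡ ∑Paths (suc n) 1 (λ v → H≡ j (w ++ v))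
  last-step w |w| rewrite inH-snoc-U w = sym (begin
    + 0 + ∑ (suc n) (λ m → H≡ j (w ++ D m ∷ []))              ≡⟨ ℤₚ.+-identityˡ _ ⟩
    ∑ (suc n) (λ m → H≡ j (w ++ D m ∷ []))                    ≡⟨ ∑-init-last n (λ m → H≡ j (w ++ D m ∷ [])) ⟩
    ∑ n (λ m → H≡ j (w ++ D m ∷ [])) + H≡ j (w ++ D n ∷ [])   ≡⟨ cong (λ b → ∑ n (λ m → H≡ j (w ++ D m ∷ [])) + χ (b ∧ (height (w ++ D n ∷ []) ≡ᵇ j)))
                                                                      (inH-snoc-too-deep w n (subst (_≤ n) (sym |w|) (ℕₚ.<⇒≤ i<n))) ⟩
    ∑ n (λ m → H≡ j (w ++ D m ∷ [])) + + 0                    ≡⟨ ℤₚ.+-identityʳ _ ⟩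
    ∑ n (λ m → H≡ j (w ++ D m ∷ []))                          ∎)

Bexact-as-difference : ∀ j i → χ ((i ≡ᵇ 0) ∧ (0 ≡ᵇ j)) + Bexact j (suc i) ≡ (B j ⊖ Bprev j) (suc i)
Bexact-as-difference zero    i rewrite Bexact-zero i | B-zero (suc i) with i
... | zero  = refl
... | suc _ = refl
Bexact-as-difference (suc j) i = begin
  χ ((i ≡ᵇ 0) ∧ false) + Bexact (suc j) (suc i)          ≡⟨ cong (λ b → χ b + Bexact (suc j) (suc i)) (Boolₚ.∧-zeroʳ (i ≡ᵇ 0)) ⟩
  + 0 + Bexact (suc j) (suc i)                           ≡⟨ ℤₚ.+-identityˡ _ ⟩
  Bexact (suc j) (suc i)                                 ≡⟨ xyx⁻¹≈y (B j (suc i)) _ ⟨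
  B j (suc i) + Bexact (suc j) (suc i) ℤ.- B j (suc i)   ≡⟨ cong (ℤ._- B j (suc i)) (B-suc j (suc i)) ⟨
  (B (suc j) ⊖ B j) (suc i)                              ∎
  where open ≡-Reasoning

∑Paths-FirstBlock : ∀ j n i → i < n → ∑Paths n (suc i) (FirstBlock (suc j)) ≡ (B j ⊖ Bprev j) i
∑Paths-FirstBlock zero    n       zero    _ = ∑Paths-FirstBlock-U 1 n 0
∑Paths-FirstBlock (suc j) n       zero    _ = ∑Paths-FirstBlock-U (suc (suc j)) n 0
∑Paths-FirstBlock j       (suc n) (suc i) (s≤s i<n) = begin
  ∑Paths (suc n) (suc (suc i)) (FirstBlock k)
    ≡⟨ ∑Paths-FirstBlock-U k (suc n) (suc i) ⟩
  ∑Paths (suc n) (suc i) F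
    ≡⟨ cong (λ l → ∑Paths (suc n) l F) (ℕₚ.+-comm 1 i) ⟩
  ∑Paths (suc n) (i ℕ.+ 1) F
    ≡⟨ ∑Paths-++ (suc n) i 1 F ⟩
  ∑Paths (suc n) i (λ w → ∑Paths (suc n) 1 (λ v → F (w ++ v)))
    ≡⟨ ∑Paths-cong (suc n) i (λ w _ → last-step w) ⟩
  ∑Paths (suc n) i (λ w → F (w ++ D 0 ∷ []) + ∑ n (λ m → H≡ j (w ++ D m ∷ [])))
    ≡⟨ ∑Paths-distrib-+ (suc n) i (λ w → F (w ++ D 0 ∷ [])) (λ w → ∑ n (λ m → H≡ j (w ++ D m ∷ []))) ⟩
  ∑Paths (suc n) i (λ w → F (w ++ D 0 ∷ [])) + ∑Paths (suc n) i (λ w → ∑ n (λ m → H≡ j (w ++ D m ∷ [])))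
    ≡⟨ cong₂ _+_ (∑Paths-UD-blocks j (suc n) i) (∑Paths-lifted-blocks j n i i<n) ⟩
  χ ((i ≡ᵇ 0) ∧ (0 ≡ᵇ j)) + Bexact j (suc i)
    ≡⟨ Bexact-as-difference j i ⟩
  (B j ⊖ Bprev j) (suc i) ∎
  where
  open ≡-Reasoning
  k = suc j
  F : Path → ℤ
  F w = FirstBlock k (U ∷ w)
  last-step : ∀ w → ∑Paths (suc n) 1 (λ v → F (w ++ v)) ≡ F (w ++ D 0 ∷ []) + ∑ n (λ m → H≡ j (w ++ D m ∷ []))
  last-step w = trans (cong (_+ ∑ (suc n) (λ m → F (w ++ D m ∷ []))) (FirstBlock-snoc-U k w))
    (trans (ℤₚ.+-identityˡ _) (cong (_+_ (F (w ++ D 0 ∷ []))) (∑-cong n (λ m _ → FirstBlock-lift j w m))))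

B-recurrence : ∀ j → B (suc j) ≗ B j ⊕ X ⊛ (B j ⊖ Bprev j) ⊛ B (suc j)
B-recurrence j n = begin
  B (suc j) n
    ≡⟨ B-suc j n ⟩
  B j n + Bexact (suc j) n
    ≡⟨ cong (_+_ (B j n)) (Bexact-firstReturn j n) ⟩
  B j n + ∑ n (λ i → ∑Paths n (suc i) (FirstBlock (suc j)) * B (suc j) (n ∸ suc i))
    ≡⟨ cong (_+_ (B j n)) (∑-cong n (λ i i<n → cong (_* B (suc j) (n ∸ suc i))
                                                    (trans (∑Paths-FirstBlock j n i i<n) (sym (X⊛-shift (B j ⊖ Bprev j) i))))) ⟩
  B j n + ∑ n (λ i → (X ⊛ (B j ⊖ Bprev j)) (suc i) * B (suc j) (n ∸ suc i))
    ≡⟨ cong (_+_ (B j n)) (ℤₚ.+-identityˡ (∑ n (λ i → (X ⊛ (B j ⊖ Bprev j)) (suc i) * B (suc j) (n ∸ suc i)))) ⟨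
  B j n + (+ 0 + ∑ n (λ i → (X ⊛ (B j ⊖ Bprev j)) (suc i) * B (suc j) (n ∸ suc i)))
    ≡⟨ cong (_+_ (B j n)) (⊛-coeff (X ⊛ (B j ⊖ Bprev j)) (B (suc j)) n) ⟨
  (B j ⊕ X ⊛ (B j ⊖ Bprev j) ⊛ B (suc j)) n ∎
  where open ≡-Reasoning

B-consecutive : ∀ j → Consecutive (Bprev j) (B j)
B-consecutive zero    = Consecutive-congʳ {one ⊖ X} {one} {B 0} (λ n → sym (B-zero n)) consecutive-base
B-consecutive (suc j) = consecutive-step {Bprev j} {B j} {B (suc j)} (B-consecutive j) (B-recurrence j)

lemma1 : (k : ℕ) → 1 ≤ k → (n : ℕ) →
    (B (k ∸ 1) ⊛ (X^ 2 ⊛ B k ⊕ X^ 1)) n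
      ≡ ((one ⊖ X^ 3 ⊕ X^ 1) ⊛ B k ⊖ one) n
lemma1 (suc j) _ = Consecutive⇒monomials {B j} {B (suc j)} (B-consecutive (suc j))
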